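{- Let $n\ge2$. For a permutation $\tau\in\mathfrak S_n$ with $\tau\neq\mathrm{id}$, let $j+1$ be the smallest element of $\{1,\dots,n\}$ not fixed by $\tau$, and let $i$ be defined by $\tau_i=j+1$ (so $i>j+1$). Define $\mathbf f_\tau:\mathfrak S_n\to\mathbb R$ by $\mathbf f_\tau(\sigma)=1$ if $(\sigma_{j+1}\sigma_{j+2}\cdots\sigma_n)$ is in the same relative order as $(\tau_{j+1}\tau_{j+2}\cdots\tau_n)$; $\mathbf f_\tau(\sigma)=-1$ if $(\sigma_{j+1}\cdots\sigma_n)$ is in the same relative order as $((j+1)\tau_{j+1}\cdots\tau_{i-1}\tau_{i+1}\cdots\tau_n)$; and $\mathbf f_\tau(\sigma)=0$ otherwise. Set $\mathbf f_{\mathrm{id}}\equiv1$ (with $j=n$). Then each $\mathbf f_\tau$ is a right eigenfunction of the top-to-random-with-standardisation chain with eigenvalue $\beta_j=\frac jn$, and of the binomial-top-to-random-with-standardisation chain with parameter $q_2$ with eigenvalue $\beta_j=q_2^{n-j}$, and $\{\mathbf f_\tau:\tau\in\mathfrak S_n\}$ is a basis of the space of functions $\mathfrak S_n\to\mathbb R$.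
   Context: Permutations are written in one-line notation $\sigma=(\sigma_1\cdots\sigma_n)$. Two strings of distinct numbers of the same length are in the same relative order if their standardisations coincide, where the standardisation of a string of distinct numbers replaces its letters by $1,2,\dots$ preserving relative order. Top-to-random-with-standardisation chain on $\mathfrak S_n$: from $\sigma$, remove the first letter $\sigma_1$, replace the remaining letters by $2,\dots,n$ preserving their relative order, then insert the letter $1$ into one of the $n$ positions chosen uniformly. Binomial-top-to-random-with-standardisation chain with parameter $q_2\in[0,1]$: choose $r\sim\mathrm{Binomial}(n,1-q_2)$, remove the first $r$ letters, replace the remaining letters by $r+1,\dots,n$ preserving their relative order, then insert the letters $1,\dots,r$ so that the result is uniformly distributed among the $n!/(n-r)!$ permutations of $\mathfrak S_n$ in which the letters $r+1,\dots,n$ appear in that relative order. A right eigenfunction with eigenvalue $\beta$ of a chain with transition matrix $K$ is $\mathbf f$ with $\sum_yK(x,y)\mathbf f(y)=\beta\mathbf f(x)$.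
   Formalization: The parameter $q_2$ takes only rational values in [0,1], and the functions $\mathfrak S_n\to\mathbb R$ in the basis claim take rational values rather than real ones. -}

module Defs where

open import Data.Nat as ℕ using (ℕ; zero; suc; _∸_; _<?_)
open import Data.Nat.Combinatorics using (_C_; _P_)
open import Data.Integer using (+_)
open import Data.Rational as ℚ using (ℚ; 0ℚ; 1ℚ; _+_; _*_; _-_; _/_)
open import Data.List using (List; []; _∷_; map; filter; take; drop; length; upTo; concatMap; foldr)
open import Data.List.Properties using (≡-dec)
open import Data.Bool using (Bool; true; false; if_then_else_)
open import Relation.Nullary using (does; ¬?)

-- Permutations of {1,…,n} in one-line notation, as lists of naturals.

insertions : ℕ → List ℕ → List (List ℕ)
insertions x []       = (x ∷ []) ∷ []
insertions x (y ∷ ys) = (x ∷ y ∷ ys) ∷ map (y ∷_) (insertions x ys)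

perms : ℕ → List (List ℕ)
perms zero    = [] ∷ []
perms (suc n) = concatMap (insertions (suc n)) (perms n)

count< : ℕ → List ℕ → ℕ
count< x []       = 0
count< x (y ∷ ys) = if does (y <? x) then suc (count< x ys) else count< x ys

std : List ℕ → List ℕ
std l = map (λ x → suc (count< x l)) l

sumQ : List ℚ → ℚ
sumQ = foldr _+_ 0ℚ

ℕtoℚ : ℕ → ℚ
ℕtoℚ k = (+ k) / 1

-- 1/k for k ≥ 1 (only ever applied to positive k)
inv : ℕ → ℚ
inv zero    = 0ℚ
inv (suc k) = (+ 1) / suc k

_^Q_ : ℚ → ℕ → ℚ
q ^Q zero  = 1ℚ
q ^Q suc k = q * (q ^Q k)

indicator : Bool → ℚ
indicator true  = 1ℚ
indicator false = 0ℚ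

eqL : List ℕ → List ℕ → Bool
eqL a b = does (≡-dec ℕ._≟_ a b)

insertAt : ℕ → ℕ → List ℕ → List ℕ
insertAt k x l = take k l Data.List.++ (x ∷ drop k l)

-- Top-to-random-with-standardisation: transition probability K(x,y).
-- Remove first letter, standardise the rest to 2..n, insert 1 at one of n
-- positions uniformly.
tail' : List ℕ → List ℕ
tail' []       = []
tail' (_ ∷ xs) = xs

Ktop : ℕ → List ℕ → List ℕ → ℚ
Ktop n x y =
  inv n * sumQ (map (λ k → indicator (eqL (insertAt k 1 (map suc (std (tail' x)))) y))
                    (upTo n))

-- Binomial-top-to-random-with-standardisation with parameter q₂:
-- r ~ Binomial(n, 1-q₂); remove first r letters, standardise the rest to
-- r+1..n, then y is uniform among the n!/(n-r)! = n P r permutations in which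
-- r+1..n appear in that relative order.
Kbin : ℕ → ℚ → List ℕ → List ℕ → ℚ
Kbin n q₂ x y =
  sumQ (map (λ r →
         ℕtoℚ (n C r) * ((1ℚ - q₂) ^Q r) * (q₂ ^Q (n ∸ r))
         * indicator (eqL (filter (λ v → r <? v) y) (map (r ℕ.+_) (std (drop r x))))
         * inv (n P r))
       (upTo (suc n)))

applyK : ℕ → (List ℕ → List ℕ → ℚ) → (List ℕ → ℚ) → List ℕ → ℚ
applyK n K f x = sumQ (map (λ y → K x y * f y) (perms n))

-- j(τ): length of the longest prefix with τ_k = k; so j+1 is the smallest
-- non-fixed point (and j = n for τ = id).
fixedPrefix : ℕ → List ℕ → ℕ
fixedPrefix k []       = 0
fixedPrefix k (x ∷ xs) = if does (x ℕ.≟ k) then suc (fixedPrefix (suc k) xs) else 0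

jOf : List ℕ → ℕ
jOf τ = fixedPrefix 1 τ

fτ : ℕ → List ℕ → List ℕ → ℚ
fτ n τ σ with does (jOf τ ℕ.≟ n)
... | true  = 1ℚ
... | false =
  let j  = jOf τ
      s  = std (drop j σ)
      p₁ = drop j τ
      p₂ = suc j ∷ filter (λ v → ¬? (v ℕ.≟ suc j)) (drop j τ)
  in if eqL s (std p₁) then 1ℚ
     else if eqL s (std p₂) then ℚ.-_ 1ℚ
     else 0ℚ

{-# OPTIONS --safe #-}

-- For τ ≠ id with j = j(τ), f_τ(σ) depends only on std(σ_{j+1} … σ_n): it is 1 on the pattern
-- T₁ = std(τ_{j+1} … τ_n), −1 on T₂ = 1 ∷ R and 0 elsewhere, where T₁ is an insertion of 1 into R
-- other than at the front. Hence its sum over all ways of inserting a new smallest letter into a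
-- word vanishes.
--
-- Both chains send σ to a uniform way of inserting the letters 1, …, r, one at a time, into
-- r + std(σ_{r+1} … σ_n). A letter inserted among the first j positions leaves the tail of the word
-- in the same relative order, and the insertions further right cancel; so the sum of f_τ over all
-- r-fold insertions is j(j−1)…(j−r+1) f_τ(σ). For the top-to-random chain (r = 1) this is the
-- eigenvalue j/n, and for the binomial chain
--   Σ_r C(n,r) (1−q₂)^r q₂^(n−r) · jPr / nPr = Σ_r C(j,r) (1−q₂)^r q₂^(n−r) = q₂^(n−j).
--
-- For the basis, every σ ∈ 𝔖_n is either 1 ∷ (ρ+1) or a later insertion of 1 into ρ+1, for a
-- unique ρ ∈ 𝔖_{n−1}. Then f_{1 ∷ (ρ+1)}(σ) = f_ρ(std(σ₂ … σ_n)), and f_τ = δ_τ − δ_{1 ∷ (ρ+1)} for a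
-- later insertion τ. So in a linear system Σ_τ c_τ f_τ = g the coefficients of later insertions are
-- read off directly, and the remaining ones solve a system on 𝔖_{n−1} in which the coefficient of
-- f_ρ is weighted by 1 + j(ρ); independence and spanning follow by induction on n.
module Submission where

open import Defs
open import Data.Nat as ℕ using (ℕ; zero; suc; _≤_; _<_; s≤s; z≤n; _∸_)
import Data.Nat.Properties as NP
open import Data.Nat.Combinatorics using (_C_; _P_; nCk≡nPk/k!; k>n⇒nCk≡0; nCk+nC[k+1]≡[n+1]C[k+1])
open import Data.Nat.Combinatorics.Base using (_P′_)
open import Data.Nat.Combinatorics.Specification using (k!∣nP′k; nP′k≡n[n∸1P′k∸1])
open import Data.Nat.DivMod using (m/n*n≡m)
open import Data.Rational using (ℚ; 0ℚ; 1ℚ; _+_; _*_; _-_; -_; toℚᵘ) renaming (_≤_ to _≤ℚ_)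
import Data.Rational.Properties as QP
import Data.Rational.Unnormalised as ℚᵘ
import Data.Rational.Unnormalised.Properties as ℚᵘP
open import Data.Rational.Solver using (module +-*-Solver)
open import Data.List as L using (List; []; _∷_; [_]; _++_; _∷ʳ_; map; filter; drop; length; upTo; concatMap)
import Data.List.Properties as LP
open import Data.List.Membership.Propositional using (_∈_; _∉_; find; lose)
open import Data.List.Membership.Propositional.Properties
  using (∈-∃++; ∈-++⁺ˡ; ∈-++⁺ʳ; ∈-++⁻; ∈-map⁺; ∈-map⁻; ∈-upTo⁻; ∈-concatMap⁺; ∈-concatMap⁻)
open import Data.List.Membership.Propositional.Properties.WithK using (unique∧set⇒bag)
open import Data.List.Relation.Binary.BagAndSetEquality using (∼bag⇒↭)
open import Data.List.Relation.Unary.Any using (here; there)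
open import Data.List.Relation.Unary.All as All using (All; []; _∷_)
open import Data.List.Relation.Unary.Unique.Propositional using (Unique; []; _∷_)
import Data.List.Relation.Unary.Unique.Propositional.Properties as UniqueP
open import Data.List.Relation.Binary.Permutation.Propositional
  using (_↭_; ↭-refl; ↭-sym; ↭-trans; ↭-prep; ↭⇒↭ₛ; module PermutationReasoning)
import Data.List.Relation.Binary.Permutation.Propositional.Properties as PermP
import Data.List.Relation.Binary.Permutation.Setoid.Properties as PermSetoidP
open import Data.Product using (Σ; _×_; _,_; proj₁; proj₂)
open import Data.Sum using (_⊎_; inj₁; inj₂)
open import Data.Empty using (⊥-elim)
open import Data.Bool using (true; false; if_then_else_)
import Data.Bool.Properties as BoolP
open import Relation.Nullary using (¬_; Dec; yes; no; does; ¬?)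
open import Relation.Nullary.Decidable using (dec-true; dec-false)
open import Relation.Unary using (Pred; Decidable)
open import Relation.Binary.Definitions using (tri<; tri≈; tri>)
open import Relation.Binary.PropositionalEquality hiding ([_])
open import Function using (_∘_; _⇔_; mk⇔; Equivalence)
open import Level using (0ℓ)

-- Rational arithmetic and sums over lists

module _ where
  open import Data.Integer as ℤ using (+_)
  import Data.Integer.Properties as ℤP
  open import Data.Integer.Solver renaming (module +-*-Solver to ℤ-Solver)
  open ℤ-Solver
  open ℚᵘP.≃-Reasoning

  private
    toℚᵘ-ℕtoℚ : ∀ k → toℚᵘ (ℕtoℚ k) ℚᵘ.≃ ℚᵘ.mkℚᵘ (+ k) 0
    toℚᵘ-ℕtoℚ k = QP.toℚᵘ-fromℚᵘ (ℚᵘ.mkℚᵘ (+ k) 0)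

  ℕtoℚ-homo-+ : ∀ a b → ℕtoℚ (a ℕ.+ b) ≡ ℕtoℚ a + ℕtoℚ b
  ℕtoℚ-homo-+ a b = QP.toℚᵘ-injective (begin
    toℚᵘ (ℕtoℚ (a ℕ.+ b))
      ≈⟨ toℚᵘ-ℕtoℚ (a ℕ.+ b) ⟩
    ℚᵘ.mkℚᵘ (+ (a ℕ.+ b)) 0
      ≈⟨ ℚᵘ.*≡* (solve 2 (λ A B → (A :+ B) :* con (+ 1) := (A :* con (+ 1) :+ B :* con (+ 1)) :* con (+ 1)) refl (+ a) (+ b)) ⟩
    ℚᵘ.mkℚᵘ (+ a) 0 ℚᵘ.+ ℚᵘ.mkℚᵘ (+ b) 0
      ≈⟨ ℚᵘP.+-cong (toℚᵘ-ℕtoℚ a) (toℚᵘ-ℕtoℚ b) ⟨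
    toℚᵘ (ℕtoℚ a) ℚᵘ.+ toℚᵘ (ℕtoℚ b)
      ≈⟨ QP.toℚᵘ-homo-+ (ℕtoℚ a) (ℕtoℚ b) ⟨
    toℚᵘ (ℕtoℚ a + ℕtoℚ b) ∎)

  ℕtoℚ-homo-* : ∀ a b → ℕtoℚ (a ℕ.* b) ≡ ℕtoℚ a * ℕtoℚ b
  ℕtoℚ-homo-* a b = QP.toℚᵘ-injective (begin
    toℚᵘ (ℕtoℚ (a ℕ.* b))                 ≈⟨ toℚᵘ-ℕtoℚ (a ℕ.* b) ⟩
    ℚᵘ.mkℚᵘ (+ (a ℕ.* b)) 0               ≈⟨ ℚᵘ.*≡* (cong (ℤ._* + 1) (ℤP.pos-* a b)) ⟩
    ℚᵘ.mkℚᵘ (+ a) 0 ℚᵘ.* ℚᵘ.mkℚᵘ (+ b) 0  ≈⟨ ℚᵘP.*-cong (toℚᵘ-ℕtoℚ a) (toℚᵘ-ℕtoℚ b) ⟨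
    toℚᵘ (ℕtoℚ a) ℚᵘ.* toℚᵘ (ℕtoℚ b)      ≈⟨ QP.toℚᵘ-homo-* (ℕtoℚ a) (ℕtoℚ b) ⟨
    toℚᵘ (ℕtoℚ a * ℕtoℚ b)                ∎)

  inv-inverseˡ : ∀ p .{{_ : ℕ.NonZero p}} → inv p * ℕtoℚ p ≡ 1ℚ
  inv-inverseˡ (suc k) = QP.toℚᵘ-injective (begin
    toℚᵘ (inv (suc k) * ℕtoℚ (suc k))
      ≈⟨ QP.toℚᵘ-homo-* (inv (suc k)) (ℕtoℚ (suc k)) ⟩
    toℚᵘ (inv (suc k)) ℚᵘ.* toℚᵘ (ℕtoℚ (suc k))
      ≈⟨ ℚᵘP.*-cong (QP.toℚᵘ-fromℚᵘ (ℚᵘ.mkℚᵘ (+ 1) k)) (toℚᵘ-ℕtoℚ (suc k)) ⟩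
    ℚᵘ.mkℚᵘ (+ 1) k ℚᵘ.* ℚᵘ.mkℚᵘ (+ suc k) 0
      ≈⟨ ℚᵘ.*≡* (solve 1 (λ K → (con (+ 1) :* (con (+ 1) :+ K)) :* con (+ 1) := con (+ 1) :* ((con (+ 1) :+ K) :* con (+ 1)))
                       refl (+ k)) ⟩
    ℚᵘ.mkℚᵘ (+ 1) 0 ∎)

inv-inverseʳ : ∀ p .{{_ : ℕ.NonZero p}} → ℕtoℚ p * inv p ≡ 1ℚ
inv-inverseʳ p = trans (QP.*-comm (ℕtoℚ p) (inv p)) (inv-inverseˡ p)

open +-*-Solver using (solve; _:=_; _:+_; _:*_; con; :-_)
open import Algebra.Properties.Group QP.+-0-group using (inverseʳ-unique; ⁻¹-involutive)

module _ {A : Set} where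

  sumQ-++ : (f : A → ℚ) (xs ys : List A) → sumQ (map f (xs ++ ys)) ≡ sumQ (map f xs) + sumQ (map f ys)
  sumQ-++ f []       ys = sym (QP.+-identityˡ _)
  sumQ-++ f (x ∷ xs) ys = trans (cong (f x +_) (sumQ-++ f xs ys)) (sym (QP.+-assoc (f x) _ _))

  sumQ-cong : (f g : A → ℚ) (xs : List A) → (∀ x → x ∈ xs → f x ≡ g x) → sumQ (map f xs) ≡ sumQ (map g xs)
  sumQ-cong f g []       f≗g = refl
  sumQ-cong f g (x ∷ xs) f≗g = cong₂ _+_ (f≗g x (here refl)) (sumQ-cong f g xs (λ y y∈ → f≗g y (there y∈)))

  sumQ-+ : (f g : A → ℚ) (xs : List A) → sumQ (map (λ x → f x + g x) xs) ≡ sumQ (map f xs) + sumQ (map g xs)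
  sumQ-+ f g []       = refl
  sumQ-+ f g (x ∷ xs) = trans (cong (f x + g x +_) (sumQ-+ f g xs))
    (solve 4 (λ a b c d → (a :+ b) :+ (c :+ d) := (a :+ c) :+ (b :+ d)) refl (f x) (g x) (sumQ (map f xs)) (sumQ (map g xs)))

  sumQ-*ˡ : (a : ℚ) (f : A → ℚ) (xs : List A) → sumQ (map (λ x → a * f x) xs) ≡ a * sumQ (map f xs)
  sumQ-*ˡ a f []       = sym (QP.*-zeroʳ a)
  sumQ-*ˡ a f (x ∷ xs) = trans (cong (a * f x +_) (sumQ-*ˡ a f xs)) (sym (QP.*-distribˡ-+ a (f x) _))

  sumQ-*ʳ : (f : A → ℚ) (a : ℚ) (xs : List A) → sumQ (map (λ x → f x * a) xs) ≡ sumQ (map f xs) * a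
  sumQ-*ʳ f a xs = trans (sumQ-cong _ _ xs (λ x _ → QP.*-comm (f x) a))
                         (trans (sumQ-*ˡ a f xs) (QP.*-comm a (sumQ (map f xs))))

  sumQ-neg : (f : A → ℚ) (xs : List A) → sumQ (map (λ x → - f x) xs) ≡ - sumQ (map f xs)
  sumQ-neg f []       = refl
  sumQ-neg f (x ∷ xs) = trans (cong (- f x +_) (sumQ-neg f xs)) (sym (QP.neg-distrib-+ (f x) _))

  sumQ-const-0 : (xs : List A) → sumQ (map (λ _ → 0ℚ) xs) ≡ 0ℚ
  sumQ-const-0 []       = refl
  sumQ-const-0 (x ∷ xs) = trans (QP.+-identityˡ _) (sumQ-const-0 xs)

  sumQ-const-1 : (xs : List A) → sumQ (map (λ _ → 1ℚ) xs) ≡ ℕtoℚ (length xs)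
  sumQ-const-1 []       = refl
  sumQ-const-1 (x ∷ xs) = trans (cong (1ℚ +_) (sumQ-const-1 xs)) (sym (ℕtoℚ-homo-+ 1 (length xs)))

  sumQ-zero : (f : A → ℚ) (xs : List A) → (∀ x → x ∈ xs → f x ≡ 0ℚ) → sumQ (map f xs) ≡ 0ℚ
  sumQ-zero f xs f≗0 = trans (sumQ-cong f (λ _ → 0ℚ) xs f≗0) (sumQ-const-0 xs)

  sumQ-↭ : (f : A → ℚ) {xs ys : List A} → xs ↭ ys → sumQ (map f xs) ≡ sumQ (map f ys)
  sumQ-↭ f xs↭ys = PermSetoidP.foldr-commMonoid (setoid ℚ) QP.+-0-isCommutativeMonoid (↭⇒↭ₛ (PermP.map⁺ f xs↭ys))

module _ {A B : Set} where

  sumQ-concatMap : (f : B → ℚ) (g : A → List B) (xs : List A) →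
    sumQ (map f (concatMap g xs)) ≡ sumQ (map (λ x → sumQ (map f (g x))) xs)
  sumQ-concatMap f g []       = refl
  sumQ-concatMap f g (x ∷ xs) = trans (sumQ-++ f (g x) (concatMap g xs)) (cong (sumQ (map f (g x)) +_) (sumQ-concatMap f g xs))

  sumQ-swap : (h : A → B → ℚ) (xs : List A) (ys : List B) →
    sumQ (map (λ x → sumQ (map (h x) ys)) xs) ≡ sumQ (map (λ y → sumQ (map (λ x → h x y) xs)) ys)
  sumQ-swap h []       ys = sym (sumQ-const-0 ys)
  sumQ-swap h (x ∷ xs) ys = trans (cong (sumQ (map (h x) ys) +_) (sumQ-swap h xs ys))
                                  (sym (sumQ-+ (h x) (λ y → sumQ (map (λ x → h x y) xs)) ys))

eqL-refl : ∀ a → eqL a a ≡ true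
eqL-refl a = dec-true (LP.≡-dec ℕ._≟_ a a) refl

eqL-≢ : ∀ {a b} → a ≢ b → eqL a b ≡ false
eqL-≢ {a} {b} = dec-false (LP.≡-dec ℕ._≟_ a b)

eqL-sym : ∀ a b → eqL a b ≡ eqL b a
eqL-sym a b with LP.≡-dec ℕ._≟_ b a
... | yes refl = eqL-refl a
... | no b≢a   = eqL-≢ (b≢a ∘ sym)

eqL-injective : ∀ {h : List ℕ → List ℕ} → (∀ {a b} → h a ≡ h b → a ≡ b) → ∀ a b → eqL (h a) (h b) ≡ eqL a b
eqL-injective {h} inj a b with LP.≡-dec ℕ._≟_ a b
... | yes refl = eqL-refl (h a)
... | no a≢b   = eqL-≢ (a≢b ∘ inj)

indicator-≢ : ∀ {a b} q → a ≢ b → indicator (eqL a b) * q ≡ 0ℚ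
indicator-≢ q a≢b = trans (cong (λ c → indicator c * q) (eqL-≢ a≢b)) (QP.*-zeroˡ q)

indicator-refl : ∀ a q → indicator (eqL a a) * q ≡ q
indicator-refl a q = trans (cong (λ c → indicator c * q) (eqL-refl a)) (QP.*-identityˡ q)

sumQ-indicator-∉ : ∀ x (g : List ℕ → ℚ) ys → x ∉ ys → sumQ (map (λ y → indicator (eqL x y) * g y) ys) ≡ 0ℚ
sumQ-indicator-∉ x g ys x∉ = sumQ-zero _ ys (λ y y∈ → indicator-≢ {x} {y} (g y) λ { refl → x∉ y∈ })

sumQ-indicator : ∀ x (g : List ℕ → ℚ) ys → Unique ys → x ∈ ys → sumQ (map (λ y → indicator (eqL x y) * g y) ys) ≡ g x
sumQ-indicator x g (.x ∷ ys) (x∉ ∷ _) (here refl) =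
  trans (cong₂ _+_ (indicator-refl x (g x)) (sumQ-indicator-∉ x g ys (λ x∈ → All.lookup x∉ x∈ refl))) (QP.+-identityʳ (g x))
sumQ-indicator x g (y ∷ ys) (y∉ ∷ u) (there x∈) =
  trans (cong₂ _+_ (indicator-≢ {x} {y} (g y) λ { refl → All.lookup y∉ x∈ refl }) (sumQ-indicator x g ys u x∈)) (QP.+-identityˡ (g x))

-- Insertions and permutations

module _ {A B : Set} (g : A → List B) where

  ∈-concatMap⁺′ : ∀ {xs a y} → y ∈ g a → a ∈ xs → y ∈ concatMap g xs
  ∈-concatMap⁺′ y∈ a∈ = ∈-concatMap⁺ g (lose a∈ y∈)

  ∈-concatMap⁻′ : ∀ xs {y} → y ∈ concatMap g xs → Σ A (λ a → a ∈ xs × y ∈ g a)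
  ∈-concatMap⁻′ xs y∈ = find (∈-concatMap⁻ g y∈)

  Unique-concatMap : ∀ xs → Unique xs → (∀ {a} → a ∈ xs → Unique (g a)) →
    (∀ {a b y} → a ∈ xs → b ∈ xs → y ∈ g a → y ∈ g b → a ≡ b) → Unique (concatMap g xs)
  Unique-concatMap []       _          _   _        = []
  Unique-concatMap (a ∷ xs) (a∉ ∷ uxs) ugs disjoint =
    UniqueP.++⁺ (ugs (here refl)) (Unique-concatMap xs uxs (ugs ∘ there) (λ p q → disjoint (there p) (there q)))
      λ { (y∈a , y∈xs) → let b , b∈ , y∈b = ∈-concatMap⁻′ xs y∈xs in
                         All.lookup a∉ b∈ (disjoint (here refl) (there b∈) y∈a y∈b) }

Unique-↭ : {A : Set} {xs ys : List A} → xs ↭ ys → Unique xs → Unique ys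
Unique-↭ xs↭ys = PermSetoidP.Unique-resp-↭ (setoid _) (↭⇒↭ₛ xs↭ys)

Unique-⇔-↭ : {A : Set} {xs ys : List A} → Unique xs → Unique ys → (∀ {x} → x ∈ xs ⇔ x ∈ ys) → xs ↭ ys
Unique-⇔-↭ uxs uys same = ∼bag⇒↭ (unique∧set⇒bag uxs uys same)

∈-insertions⁺ : ∀ (x : ℕ) u v → u ++ x ∷ v ∈ insertions x (u ++ v)
∈-insertions⁺ x []      []      = here refl
∈-insertions⁺ x []      (y ∷ v) = here refl
∈-insertions⁺ x (w ∷ u) v       = there (∈-map⁺ (w ∷_) (∈-insertions⁺ x u v))

∈-insertions⁻ : ∀ {x : ℕ} w {l} → l ∈ insertions x w → Σ (List ℕ) λ u → Σ (List ℕ) λ v → w ≡ u ++ v × l ≡ u ++ x ∷ v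
∈-insertions⁻ []      (here refl) = [] , [] , refl , refl
∈-insertions⁻ (y ∷ w) (here refl) = [] , y ∷ w , refl , refl
∈-insertions⁻ (y ∷ w) (there l∈) with ∈-map⁻ (y ∷_) l∈
... | l′ , l′∈ , refl with ∈-insertions⁻ w l′∈
... | u , v , refl , refl = y ∷ u , v , refl , refl

head∈insertions : ∀ (x : ℕ) w → x ∷ w ∈ insertions x w
head∈insertions x []      = here refl
head∈insertions x (y ∷ w) = here refl

insertions-↭ : ∀ {x : ℕ} w {l} → l ∈ insertions x w → l ↭ x ∷ w
insertions-↭ {x} w l∈ with ∈-insertions⁻ w l∈
... | u , v , refl , refl = PermP.shift x u v

filter-insertions : ∀ {P : Pred ℕ 0ℓ} (P? : Decidable P) {x : ℕ} w {l} → ¬ P x → l ∈ insertions x w → filter P? l ≡ filter P? w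
filter-insertions P? {x} w ¬Px l∈ with ∈-insertions⁻ w l∈
... | u , v , refl , refl = begin
  filter P? (u ++ x ∷ v)           ≡⟨ LP.filter-++ P? u (x ∷ v) ⟩
  filter P? u ++ filter P? (x ∷ v) ≡⟨ cong (filter P? u ++_) (LP.filter-reject P? ¬Px) ⟩
  filter P? u ++ filter P? v       ≡⟨ LP.filter-++ P? u v ⟨
  filter P? (u ++ v)               ∎
  where open ≡-Reasoning

insertions-injective : ∀ {x : ℕ} {w w′ l} → x ∉ w → x ∉ w′ → l ∈ insertions x w → l ∈ insertions x w′ → w ≡ w′
insertions-injective {x} {w} {w′} {l} x∉w x∉w′ l∈w l∈w′ = begin
  w                  ≡⟨ LP.filter-all ≢x? (≢x x∉w) ⟨
  filter ≢x? w       ≡⟨ filter-insertions ≢x? w (λ x≢x → x≢x refl) l∈w ⟨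
  filter ≢x? l       ≡⟨ filter-insertions ≢x? w′ (λ x≢x → x≢x refl) l∈w′ ⟩
  filter ≢x? w′      ≡⟨ LP.filter-all ≢x? (≢x x∉w′) ⟩
  w′                 ∎
  where
  open ≡-Reasoning
  ≢x? : Decidable (_≢ x)
  ≢x? v = ¬? (v ℕ.≟ x)
  ≢x : ∀ {z} → x ∉ z → All (_≢ x) z
  ≢x x∉z = All.tabulate λ { y∈ refl → x∉z y∈ }

insertions-unique : ∀ {x : ℕ} w → x ∉ w → Unique (insertions x w)
insertions-unique []      _  = [] ∷ []
insertions-unique {x} (y ∷ w) x∉ =
  All.tabulate (λ l∈ → head≢ l∈) ∷ UniqueP.map⁺ (λ { refl → refl }) (insertions-unique w (x∉ ∘ there))
  where
  head≢ : ∀ {l} → l ∈ map (y ∷_) (insertions x w) → x ∷ y ∷ w ≢ l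
  head≢ l∈ refl with ∈-map⁻ (y ∷_) l∈
  ... | _ , _ , x∷w≡y∷_ = x∉ (here (proj₁ (LP.∷-injective x∷w≡y∷_)))

map-insertions : (h : ℕ → ℕ) (x : ℕ) (w : List ℕ) → map (map h) (insertions x w) ≡ insertions (h x) (map h w)
map-insertions h x []      = refl
map-insertions h x (y ∷ w) = cong ((h x ∷ h y ∷ map h w) ∷_) (begin
  map (map h) (map (y ∷_) (insertions x w))   ≡⟨ LP.map-∘ (insertions x w) ⟨
  map (map h ∘ (y ∷_)) (insertions x w)       ≡⟨ LP.map-∘ (insertions x w) ⟩
  map (h y ∷_) (map (map h) (insertions x w)) ≡⟨ cong (map (h y ∷_)) (map-insertions h x w) ⟩
  map (h y ∷_) (insertions (h x) (map h w))   ∎)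
  where open ≡-Reasoning

length-insertions : (x : ℕ) (w : List ℕ) → length (insertions x w) ≡ suc (length w)
length-insertions x []      = refl
length-insertions x (y ∷ w) = cong suc (trans (LP.length-map (y ∷_) (insertions x w)) (length-insertions x w))

insertions≡map-insertAt : (x : ℕ) (w : List ℕ) → insertions x w ≡ map (λ k → insertAt k x w) (upTo (suc (length w)))
insertions≡map-insertAt x []      = refl
insertions≡map-insertAt x (y ∷ w) = cong ((x ∷ y ∷ w) ∷_) (begin
  map (y ∷_) (insertions x w)
    ≡⟨ cong (map (y ∷_)) (insertions≡map-insertAt x w) ⟩
  map (y ∷_) (map (λ k → insertAt k x w) (upTo (suc (length w))))
    ≡⟨ LP.map-∘ (upTo (suc (length w))) ⟨
  map (λ k → insertAt (suc k) x (y ∷ w)) (upTo (suc (length w)))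
    ≡⟨ LP.map-∘ (upTo (suc (length w))) ⟩
  map (λ k → insertAt k x (y ∷ w)) (map suc (upTo (suc (length w))))
    ≡⟨ cong (map (λ k → insertAt k x (y ∷ w))) (LP.map-upTo suc (suc (length w))) ⟩
  map (λ k → insertAt k x (y ∷ w)) (L.applyUpTo suc (suc (length w))) ∎)
  where open ≡-Reasoning

interval : ℕ → ℕ → List ℕ
interval a zero    = []
interval a (suc k) = a ∷ interval (suc a) k

length-interval : ∀ a k → length (interval a k) ≡ k
length-interval a zero    = refl
length-interval a (suc k) = cong suc (length-interval (suc a) k)

interval-∷ʳ : ∀ a k → interval a (suc k) ≡ interval a k ∷ʳ (a ℕ.+ k)
interval-∷ʳ a zero    = cong [_] (sym (NP.+-identityʳ a))
interval-∷ʳ a (suc k) = cong (a ∷_) (trans (interval-∷ʳ (suc a) k) (cong (interval (suc a) k ∷ʳ_) (sym (NP.+-suc a k))))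

interval-++ : ∀ a m k → interval a m ++ interval (a ℕ.+ m) k ≡ interval a (m ℕ.+ k)
interval-++ a zero    k = cong (λ z → interval z k) (NP.+-identityʳ a)
interval-++ a (suc m) k = cong (a ∷_) (trans (cong (λ z → interval (suc a) m ++ interval z k) (NP.+-suc a m)) (interval-++ (suc a) m k))

∈-interval⁻ : ∀ {x a k} → x ∈ interval a k → a ≤ x × x < a ℕ.+ k
∈-interval⁻ {a = a} {suc k} (here refl) = NP.≤-refl , NP.m<m+n a (s≤s z≤n)
∈-interval⁻ {x} {a} {suc k} (there x∈) with ∈-interval⁻ x∈
... | a<x , x<a+1+k = NP.<⇒≤ a<x , subst (x <_) (sym (NP.+-suc a k)) x<a+1+k

interval-unique : ∀ a k → Unique (interval a k)
interval-unique a zero    = []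
interval-unique a (suc k) = All.tabulate (λ x∈ a≡x → NP.<-irrefl a≡x (proj₁ (∈-interval⁻ x∈))) ∷ interval-unique (suc a) k

map-+-interval : ∀ m a k → map (m ℕ.+_) (interval a k) ≡ interval (m ℕ.+ a) k
map-+-interval m a zero    = refl
map-+-interval m a (suc k) = cong (m ℕ.+ a ∷_) (trans (map-+-interval m (suc a) k) (cong (λ z → interval z k) (NP.+-suc m a)))

map-∸-interval : ∀ m a k → map (_∸ m) (interval (m ℕ.+ a) k) ≡ interval a k
map-∸-interval m a zero    = refl
map-∸-interval m a (suc k) =
  cong₂ _∷_ (NP.m+n∸m≡n m a) (trans (cong (λ z → map (_∸ m) (interval z k)) (sym (NP.+-suc m a))) (map-∸-interval m (suc a) k))

last∈interval : ∀ n → suc n ∈ interval 1 (suc n)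
last∈interval n = subst (suc n ∈_) (sym (interval-∷ʳ 1 n)) (∈-++⁺ʳ (interval 1 n) (here refl))

∈-perms⇒↭ : ∀ n {l} → l ∈ perms n → l ↭ interval 1 n
∈-perms⇒↭ zero    (here refl) = ↭-refl
∈-perms⇒↭ (suc n) l∈ with ∈-concatMap⁻′ (insertions (suc n)) (perms n) l∈
... | ρ , ρ∈ , l∈ρ = begin
  _                               ↭⟨ insertions-↭ ρ l∈ρ ⟩
  suc n ∷ ρ                       ↭⟨ ↭-prep (suc n) (∈-perms⇒↭ n ρ∈) ⟩
  suc n ∷ interval 1 n            ↭⟨ PermP.∷↭∷ʳ (suc n) (interval 1 n) ⟩
  interval 1 n ∷ʳ suc n           ≡⟨ interval-∷ʳ 1 n ⟨
  interval 1 (suc n)              ∎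
  where open PermutationReasoning

↭⇒∈-perms : ∀ n {l} → l ↭ interval 1 n → l ∈ perms n
↭⇒∈-perms zero    l↭ rewrite PermP.↭-empty-inv l↭ = here refl
↭⇒∈-perms (suc n) {l} l↭ with ∈-∃++ (PermP.∈-resp-↭ (↭-sym l↭) (last∈interval n))
... | u , v , refl = ∈-concatMap⁺′ (insertions (suc n)) (∈-insertions⁺ (suc n) u v) (↭⇒∈-perms n u++v↭)
  where
  u++v↭ : u ++ v ↭ interval 1 n
  u++v↭ = ↭-trans (PermP.drop-mid u (interval 1 n) (subst (u ++ [ suc n ] ++ v ↭_) (interval-∷ʳ 1 n) l↭))
                  (PermP.++-identityʳ (interval 1 n))

∈-perms-bounds : ∀ n {l x} → l ∈ perms n → x ∈ l → 1 ≤ x × x ≤ n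
∈-perms-bounds n l∈ x∈ with ∈-interval⁻ (PermP.∈-resp-↭ (∈-perms⇒↭ n l∈) x∈)
... | 1≤x , x<1+n = 1≤x , NP.≤-pred x<1+n

∈-perms⇒Unique : ∀ n {l} → l ∈ perms n → Unique l
∈-perms⇒Unique n l∈ = Unique-↭ (↭-sym (∈-perms⇒↭ n l∈)) (interval-unique 1 n)

length-∈-perms : ∀ n {l} → l ∈ perms n → length l ≡ n
length-∈-perms n l∈ = trans (PermP.↭-length (∈-perms⇒↭ n l∈)) (length-interval 1 n)

perms-unique : ∀ n → Unique (perms n)
perms-unique zero    = [] ∷ []
perms-unique (suc n) = Unique-concatMap (insertions (suc n)) (perms n) (perms-unique n)
  (λ ρ∈ → insertions-unique _ (n+1∉ ρ∈)) (λ ρ∈ ρ′∈ → insertions-injective (n+1∉ ρ∈) (n+1∉ ρ′∈))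
  where
  n+1∉ : ∀ {ρ} → ρ ∈ perms n → suc n ∉ ρ
  n+1∉ ρ∈ n+1∈ = NP.<-irrefl refl (proj₂ (∈-perms-bounds n ρ∈ n+1∈))

insertionsRun : ℕ → ℕ → List ℕ → List (List ℕ)
insertionsRun a zero    Z = [ Z ]
insertionsRun a (suc r) Z = concatMap (insertions a) (insertionsRun (suc a) r Z)

Above : ℕ → List ℕ → Set
Above b Z = ∀ {z} → z ∈ Z → b ≤ z

insertionsRun-↭ : ∀ a r Z {l} → l ∈ insertionsRun a r Z → l ↭ interval a r ++ Z
insertionsRun-↭ a zero    Z (here refl) = ↭-refl
insertionsRun-↭ a (suc r) Z l∈ with ∈-concatMap⁻′ (insertions a) (insertionsRun (suc a) r Z) l∈
... | w , w∈ , l∈w = ↭-trans (insertions-↭ w l∈w) (↭-prep a (insertionsRun-↭ (suc a) r Z w∈))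

insertionsRun-Above : ∀ a r Z {l} → Above (a ℕ.+ r) Z → l ∈ insertionsRun a r Z → Above a l
insertionsRun-Above a r Z Z≥ l∈ x∈ with ∈-++⁻ (interval a r) (PermP.∈-resp-↭ (insertionsRun-↭ a r Z l∈) x∈)
... | inj₁ x∈run = proj₁ (∈-interval⁻ x∈run)
... | inj₂ x∈Z   = NP.≤-trans (NP.m≤m+n a r) (Z≥ x∈Z)

private
  Above-suc : ∀ a r {Z} → Above (a ℕ.+ suc r) Z → Above (suc a ℕ.+ r) Z
  Above-suc a r Z≥ {z} z∈ = subst (_≤ z) (NP.+-suc a r) (Z≥ z∈)

insertionsRun-unique : ∀ a r Z → Unique Z → Above (a ℕ.+ r) Z → Unique (insertionsRun a r Z)
insertionsRun-unique a zero    Z uZ Z≥ = [] ∷ []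
insertionsRun-unique a (suc r) Z uZ Z≥ =
  Unique-concatMap (insertions a) (insertionsRun (suc a) r Z) (insertionsRun-unique (suc a) r Z uZ (Above-suc a r Z≥))
    (λ w∈ → insertions-unique _ (a∉ w∈)) (λ w∈ w′∈ → insertions-injective (a∉ w∈) (a∉ w′∈))
  where
  a∉ : ∀ {w} → w ∈ insertionsRun (suc a) r Z → a ∉ w
  a∉ w∈ a∈ = NP.<-irrefl refl (insertionsRun-Above (suc a) r Z (Above-suc a r Z≥) w∈ a∈)

filter-insertionsRun : ∀ b a r Z {l} → Above (suc b) Z → a ℕ.+ r ≤ suc b → l ∈ insertionsRun a r Z → filter (b ℕ.<?_) l ≡ Z
filter-insertionsRun b a zero    Z Z> _ (here refl) = LP.filter-all (b ℕ.<?_) (All.tabulate Z>)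
filter-insertionsRun b a (suc r) Z Z> a+r≤b l∈ with ∈-concatMap⁻′ (insertions a) (insertionsRun (suc a) r Z) l∈
... | w , w∈ , l∈w = trans (filter-insertions (b ℕ.<?_) w b≮a l∈w) (filter-insertionsRun b (suc a) r Z Z> a+r≤b′ w∈)
  where
  a+r≤b′ : suc a ℕ.+ r ≤ suc b
  a+r≤b′ = subst (_≤ suc b) (NP.+-suc a r) a+r≤b
  b≮a : ¬ b < a
  b≮a b<a = NP.<-irrefl refl (NP.≤-trans (NP.≤-trans (s≤s (NP.m≤m+n a r)) a+r≤b′) b<a)

insertionsRun-complete : ∀ a r Z {l} → l ↭ interval a r ++ Z → Σ (List ℕ) λ Z′ → Z′ ↭ Z × l ∈ insertionsRun a r Z′
insertionsRun-complete a zero    Z {l} l↭ = l , l↭ , here refl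
insertionsRun-complete a (suc r) Z l↭ with ∈-∃++ (PermP.∈-resp-↭ (↭-sym l↭) (here refl))
... | u , v , refl with insertionsRun-complete (suc a) r Z (PermP.drop-mid u [] l↭)
... | Z′ , Z′↭Z , u++v∈ = Z′ , Z′↭Z , ∈-concatMap⁺′ (insertions a) (∈-insertions⁺ a u v) u++v∈

length-concatMap-const : {A B : Set} (g : A → List B) (xs : List A) (c : ℕ) → (∀ {x} → x ∈ xs → length (g x) ≡ c) →
  length (concatMap g xs) ≡ length xs ℕ.* c
length-concatMap-const g []       c _  = refl
length-concatMap-const g (x ∷ xs) c ∣g∣≡c =
  trans (LP.length-++ (g x)) (cong₂ ℕ._+_ (∣g∣≡c (here refl)) (length-concatMap-const g xs c (∣g∣≡c ∘ there)))

length-∈-insertionsRun : ∀ a r Z {l} → l ∈ insertionsRun a r Z → length l ≡ length Z ℕ.+ r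
length-∈-insertionsRun a r Z {l} l∈ = begin
  length l                           ≡⟨ PermP.↭-length (insertionsRun-↭ a r Z l∈) ⟩
  length (interval a r ++ Z)         ≡⟨ LP.length-++ (interval a r) ⟩
  length (interval a r) ℕ.+ length Z ≡⟨ cong (ℕ._+ length Z) (length-interval a r) ⟩
  r ℕ.+ length Z                     ≡⟨ NP.+-comm r (length Z) ⟩
  length Z ℕ.+ r                     ∎
  where open ≡-Reasoning

length-insertionsRun : ∀ a r Z → length (insertionsRun a r Z) ≡ (length Z ℕ.+ r) P′ r
length-insertionsRun a zero    Z = refl
length-insertionsRun a (suc r) Z = begin
  length (concatMap (insertions a) (insertionsRun (suc a) r Z))
    ≡⟨ length-concatMap-const (insertions a) _ (suc m) ∣ins∣ ⟩
  length (insertionsRun (suc a) r Z) ℕ.* suc m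
    ≡⟨ cong (ℕ._* suc m) (length-insertionsRun (suc a) r Z) ⟩
  (m P′ r) ℕ.* suc m
    ≡⟨ NP.*-comm (m P′ r) (suc m) ⟩
  suc m ℕ.* (m P′ r)
    ≡⟨ nP′k≡n[n∸1P′k∸1] (suc m) (suc r) ⟨
  suc m P′ suc r
    ≡⟨ cong (_P′ suc r) (NP.+-suc (length Z) r) ⟨
  (length Z ℕ.+ suc r) P′ suc r ∎
  where
  open ≡-Reasoning
  m = length Z ℕ.+ r
  ∣ins∣ : ∀ {w} → w ∈ insertionsRun (suc a) r Z → length (insertions a w) ≡ suc m
  ∣ins∣ {w} w∈ = trans (length-insertions a w) (cong suc (length-∈-insertionsRun (suc a) r Z w∈))

permsSplit : ℕ → ℕ → List (List ℕ)
permsSplit r k = concatMap (λ ρ → insertionsRun 1 r (map (r ℕ.+_) ρ)) (perms k)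

Above-shift-perm : ∀ r k {ρ} → ρ ∈ perms k → Above (suc r) (map (r ℕ.+_) ρ)
Above-shift-perm r k ρ∈ z∈ with ∈-map⁻ (r ℕ.+_) z∈
... | x , x∈ , refl = subst (_≤ r ℕ.+ x) (NP.+-comm r 1) (NP.+-monoʳ-≤ r (proj₁ (∈-perms-bounds k ρ∈ x∈)))

∈-permsSplit⇒↭ : ∀ r k {l} → l ∈ permsSplit r k → l ↭ interval 1 (r ℕ.+ k)
∈-permsSplit⇒↭ r k {l} l∈ with ∈-concatMap⁻′ (λ ρ → insertionsRun 1 r (map (r ℕ.+_) ρ)) (perms k) l∈
... | ρ , ρ∈ , l∈ρ = begin
  l                                           ↭⟨ insertionsRun-↭ 1 r _ l∈ρ ⟩
  interval 1 r ++ map (r ℕ.+_) ρ              ↭⟨ PermP.++⁺ˡ (interval 1 r) (PermP.map⁺ (r ℕ.+_) (∈-perms⇒↭ k ρ∈)) ⟩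
  interval 1 r ++ map (r ℕ.+_) (interval 1 k) ≡⟨ cong (interval 1 r ++_) (map-+-interval r 1 k) ⟩
  interval 1 r ++ interval (r ℕ.+ 1) k        ≡⟨ cong (λ a → interval 1 r ++ interval a k) (NP.+-comm r 1) ⟩
  interval 1 r ++ interval (1 ℕ.+ r) k        ≡⟨ interval-++ 1 r k ⟩
  interval 1 (r ℕ.+ k)                        ∎
  where open PermutationReasoning

↭⇒∈-permsSplit : ∀ r k {l} → l ↭ interval 1 (r ℕ.+ k) → l ∈ permsSplit r k
↭⇒∈-permsSplit r k {l} l↭ with insertionsRun-complete 1 r (interval (suc r) k) (subst (l ↭_) (sym (interval-++ 1 r k)) l↭)
... | Z′ , Z′↭ , l∈ = ∈-concatMap⁺′ (λ ρ → insertionsRun 1 r (map (r ℕ.+_) ρ))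
                        (subst (λ Z → l ∈ insertionsRun 1 r Z) (sym unshift) l∈) (↭⇒∈-perms k ρ↭)
  where
  ρ : List ℕ
  ρ = map (_∸ r) Z′
  ρ↭ : ρ ↭ interval 1 k
  ρ↭ = subst (ρ ↭_) (trans (cong (λ a → map (_∸ r) (interval a k)) (NP.+-comm 1 r)) (map-∸-interval r 1 k))
             (PermP.map⁺ (_∸ r) Z′↭)
  unshift : map (r ℕ.+_) ρ ≡ Z′
  unshift = trans (sym (LP.map-∘ Z′)) (trans (LP.map-cong-local (All.tabulate (λ z∈ →
    NP.m+[n∸m]≡n (NP.<⇒≤ (proj₁ (∈-interval⁻ (PermP.∈-resp-↭ Z′↭ z∈))))))) (LP.map-id Z′))

permsSplit-unique : ∀ r k → Unique (permsSplit r k)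
permsSplit-unique r k = Unique-concatMap (λ ρ → insertionsRun 1 r (map (r ℕ.+_) ρ)) (perms k) (perms-unique k)
  (λ {ρ} ρ∈ → insertionsRun-unique 1 r (map (r ℕ.+_) ρ) (UniqueP.map⁺ (NP.+-cancelˡ-≡ r _ _) (∈-perms⇒Unique k ρ∈))
                 (Above-shift-perm r k ρ∈))
  (λ {ρ} {ρ′} ρ∈ ρ′∈ l∈ l∈′ → LP.map-injective (NP.+-cancelˡ-≡ r _ _)
     (trans (sym (filter-insertionsRun r 1 r (map (r ℕ.+_) ρ) (Above-shift-perm r k ρ∈) NP.≤-refl l∈))
            (filter-insertionsRun r 1 r (map (r ℕ.+_) ρ′) (Above-shift-perm r k ρ′∈) NP.≤-refl l∈′)))

perms↭permsSplit : ∀ r k → perms (r ℕ.+ k) ↭ permsSplit r k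
perms↭permsSplit r k = Unique-⇔-↭ (perms-unique (r ℕ.+ k)) (permsSplit-unique r k)
  (mk⇔ (↭⇒∈-permsSplit r k ∘ ∈-perms⇒↭ (r ℕ.+ k)) (↭⇒∈-perms (r ℕ.+ k) ∘ ∈-permsSplit⇒↭ r k))

∈-perms-suc⁻ : ∀ n {σ} → σ ∈ perms (suc n) → Σ (List ℕ) λ ρ → ρ ∈ perms n × σ ∈ insertions 1 (map suc ρ)
∈-perms-suc⁻ n σ∈
  with ∈-concatMap⁻′ (λ ρ → insertionsRun 1 1 (map suc ρ)) (perms n) (↭⇒∈-permsSplit 1 n (∈-perms⇒↭ (suc n) σ∈))
... | ρ , ρ∈ , σ∈ρ = ρ , ρ∈ , subst (_ ∈_) (LP.++-identityʳ _) σ∈ρ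

∈-perms-suc⁺ : ∀ n {ρ σ} → ρ ∈ perms n → σ ∈ insertions 1 (map suc ρ) → σ ∈ perms (suc n)
∈-perms-suc⁺ n ρ∈ σ∈ =
  ↭⇒∈-perms (suc n) (∈-permsSplit⇒↭ 1 n (∈-concatMap⁺′ (λ ρ → insertionsRun 1 1 (map suc ρ)) (∈-++⁺ˡ σ∈) ρ∈))

-- Standardisation

rank : List ℕ → ℕ → ℕ
rank l x = suc (count< x l)

count<-yes : ∀ {x y} ys → y < x → count< x (y ∷ ys) ≡ suc (count< x ys)
count<-yes {x} {y} ys y<x = cong (λ b → if b then suc (count< x ys) else count< x ys) (dec-true (y ℕ.<? x) y<x)

count<-no : ∀ {x y} ys → ¬ y < x → count< x (y ∷ ys) ≡ count< x ys
count<-no {x} {y} ys y≮x = cong (λ b → if b then suc (count< x ys) else count< x ys) (dec-false (y ℕ.<? x) y≮x)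

count<≡length-filter : ∀ x l → count< x l ≡ length (filter (ℕ._<? x) l)
count<≡length-filter x []      = refl
-- Both sides branch on `does (y <? x)`, which computes to `y <ᵇ x`.
count<≡length-filter x (y ∷ l) with y ℕ.<ᵇ x
... | true  = cong suc (count<≡length-filter x l)
... | false = count<≡length-filter x l

count<-↭ : ∀ x {l l′} → l ↭ l′ → count< x l ≡ count< x l′
count<-↭ x {l} {l′} l↭l′ = begin
  count< x l                      ≡⟨ count<≡length-filter x l ⟩
  length (filter (ℕ._<? x) l)     ≡⟨ PermP.↭-length (PermP.filter-↭ (ℕ._<? x) l↭l′) ⟩
  length (filter (ℕ._<? x) l′)    ≡⟨ count<≡length-filter x l′ ⟨
  count< x l′                     ∎
  where open ≡-Reasoning

count<-Above : ∀ x l → Above x l → count< x l ≡ 0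
count<-Above x []      _   = refl
count<-Above x (y ∷ l) l≥x = trans (count<-no l (NP.≤⇒≯ (l≥x (here refl)))) (count<-Above x l (l≥x ∘ there))

count<-mono : ∀ {x y} l → x ≤ y → count< x l ≤ count< y l
count<-mono []      x≤y = z≤n
count<-mono {x} {y} (z ∷ l) x≤y with z ℕ.<? x | z ℕ.<? y
... | yes z<x | yes z<y = subst₂ _≤_ (sym (count<-yes l z<x)) (sym (count<-yes l z<y)) (s≤s (count<-mono l x≤y))
... | yes z<x | no  z≮y = ⊥-elim (z≮y (NP.<-≤-trans z<x x≤y))
... | no  z≮x | yes z<y = subst₂ _≤_ (sym (count<-no l z≮x)) (sym (count<-yes l z<y)) (NP.m≤n⇒m≤1+n (count<-mono l x≤y))
... | no  z≮x | no  z≮y = subst₂ _≤_ (sym (count<-no l z≮x)) (sym (count<-no l z≮y)) (count<-mono l x≤y)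

count<-strict : ∀ {x y} l → x ∈ l → x < y → count< x l < count< y l
count<-strict {x} {y} (z ∷ l) (here refl) x<y =
  subst₂ _<_ (sym (count<-no l (NP.<-irrefl refl))) (sym (count<-yes l x<y)) (s≤s (count<-mono l (NP.<⇒≤ x<y)))
count<-strict {x} {y} (z ∷ l) (there x∈) x<y with z ℕ.<? x | z ℕ.<? y
... | yes z<x | yes z<y = subst₂ _<_ (sym (count<-yes l z<x)) (sym (count<-yes l z<y)) (s≤s (count<-strict l x∈ x<y))
... | yes z<x | no  z≮y = ⊥-elim (z≮y (NP.<-trans z<x x<y))
... | no  z≮x | yes z<y = subst₂ _<_ (sym (count<-no l z≮x)) (sym (count<-yes l z<y)) (NP.m≤n⇒m≤1+n (count<-strict l x∈ x<y))
... | no  z≮x | no  z≮y = subst₂ _<_ (sym (count<-no l z≮x)) (sym (count<-no l z≮y)) (count<-strict l x∈ x<y)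

StrictlyMonotoneOn : List ℕ → (ℕ → ℕ) → Set
StrictlyMonotoneOn l g = ∀ {a b} → a ∈ l → b ∈ l → a < b → g a < g b

rank-strictlyMonotone : ∀ l → StrictlyMonotoneOn l (rank l)
rank-strictlyMonotone l a∈ _ a<b = s≤s (count<-strict l a∈ a<b)

count<-map : ∀ (g : ℕ → ℕ) l {x} → StrictlyMonotoneOn l g → x ∈ l → ∀ l′ → (∀ {y} → y ∈ l′ → y ∈ l) →
  count< (g x) (map g l′) ≡ count< x l′
count<-map g l {x} g↑ x∈ []       _   = refl
count<-map g l {x} g↑ x∈ (y ∷ l′) l′⊆l with y ℕ.<? x | g y ℕ.<? g x
... | yes y<x | yes gy<gx =
  trans (count<-yes (map g l′) gy<gx) (trans (cong suc (count<-map g l g↑ x∈ l′ (l′⊆l ∘ there))) (sym (count<-yes l′ y<x)))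
... | yes y<x | no  gy≮gx = ⊥-elim (gy≮gx (g↑ (l′⊆l (here refl)) x∈ y<x))
... | no  y≮x | yes gy<gx with NP.<-cmp y x
...   | tri< y<x _ _ = ⊥-elim (y≮x y<x)
...   | tri≈ _ refl _ = ⊥-elim (NP.<-irrefl refl gy<gx)
...   | tri> _ _ x<y = ⊥-elim (NP.<-asym gy<gx (g↑ x∈ (l′⊆l (here refl)) x<y))
count<-map g l {x} g↑ x∈ (y ∷ l′) l′⊆l | no y≮x | no gy≮gx =
  trans (count<-no (map g l′) gy≮gx) (trans (count<-map g l g↑ x∈ l′ (l′⊆l ∘ there)) (sym (count<-no l′ y≮x)))

std-map : ∀ (g : ℕ → ℕ) l → StrictlyMonotoneOn l g → std (map g l) ≡ std l
std-map g l g↑ =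
  trans (sym (LP.map-∘ l)) (LP.map-cong-local (All.tabulate (λ x∈ → cong suc (count<-map g l g↑ x∈ l (λ y∈ → y∈)))))

std-map-suc : ∀ l → std (map suc l) ≡ std l
std-map-suc l = std-map suc l (λ _ _ → s≤s)

std-map-+ : ∀ r l → std (map (r ℕ.+_) l) ≡ std l
std-map-+ r l = std-map (r ℕ.+_) l (λ _ _ → NP.+-monoʳ-< r)

∈-drop⇒∈ : ∀ i (l : List ℕ) {y} → y ∈ drop i l → y ∈ l
∈-drop⇒∈ zero    l       y∈ = y∈
∈-drop⇒∈ (suc i) []      y∈ = y∈
∈-drop⇒∈ (suc i) (x ∷ l) y∈ = there (∈-drop⇒∈ i l y∈)

std-drop-std : ∀ i l → std (drop i (std l)) ≡ std (drop i l)
std-drop-std i l = trans (cong std (LP.drop-map i l))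
  (std-map (rank l) (drop i l) (λ a∈ b∈ → rank-strictlyMonotone l (∈-drop⇒∈ i l a∈) (∈-drop⇒∈ i l b∈)))

1∉map-suc-std : ∀ l → 1 ∉ map suc (std l)
1∉map-suc-std l 1∈ with ∈-map⁻ suc 1∈
... | x , x∈ , 1≡1+x with ∈-map⁻ (rank l) x∈
... | _ , _ , refl = NP.0≢1+n (NP.suc-injective 1≡1+x)

count<-interval : ∀ a k x → a ≤ x → x ≤ a ℕ.+ k → count< x (interval a k) ≡ x ∸ a
count<-interval a zero    x a≤x x≤a = sym (NP.m≤n⇒m∸n≡0 (subst (x ≤_) (NP.+-identityʳ a) x≤a))
count<-interval a (suc k) x a≤x x≤a+k with a ℕ.<? x
... | yes a<x = begin
  count< x (a ∷ interval (suc a) k)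
    ≡⟨ count<-yes (interval (suc a) k) a<x ⟩
  suc (count< x (interval (suc a) k))
    ≡⟨ cong suc (count<-interval (suc a) k x a<x (subst (x ≤_) (NP.+-suc a k) x≤a+k)) ⟩
  suc (x ∸ suc a)
    ≡⟨ NP.+-∸-assoc 1 a<x ⟨
  x ∸ a ∎
  where open ≡-Reasoning
... | no a≮x = begin
  count< x (a ∷ interval (suc a) k)
    ≡⟨ count<-no (interval (suc a) k) a≮x ⟩
  count< x (interval (suc a) k)
    ≡⟨ count<-Above x (interval (suc a) k) (λ y∈ → NP.≤-trans (NP.≮⇒≥ a≮x) (NP.<⇒≤ (proj₁ (∈-interval⁻ y∈)))) ⟩
  0
    ≡⟨ NP.m≤n⇒m∸n≡0 (NP.≮⇒≥ a≮x) ⟨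
  x ∸ a ∎
  where open ≡-Reasoning

std-perm : ∀ n {l} → l ∈ perms n → std l ≡ l
std-perm n {l} l∈ = trans (LP.map-cong-local (All.tabulate rank≡id)) (LP.map-id l)
  where
  rank≡id : ∀ {x} → x ∈ l → rank l x ≡ x
  rank≡id {x} x∈ with ∈-perms-bounds n l∈ x∈
  ... | 1≤x , x≤n =
    trans (cong suc (trans (count<-↭ x (∈-perms⇒↭ n l∈)) (count<-interval 1 n x 1≤x (NP.m≤n⇒m≤1+n x≤n)))) (NP.m+[n∸m]≡n 1≤x)

std-∷-min : ∀ a w → Above (suc a) w → std (a ∷ w) ≡ 1 ∷ map suc (std w)
std-∷-min a w w>a = cong₂ _∷_ rank-a rank-w
  where
  rank-a : rank (a ∷ w) a ≡ 1
  rank-a = cong suc (trans (count<-no w (NP.<-irrefl refl)) (count<-Above a w (NP.<⇒≤ ∘ w>a)))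
  rank-w : map (rank (a ∷ w)) w ≡ map suc (std w)
  rank-w = trans (LP.map-cong-local (All.tabulate (λ y∈ → cong suc (count<-yes w (w>a y∈))))) (LP.map-∘ w)

std-insertions : ∀ a w → Above (suc a) w → map std (insertions a w) ≡ insertions 1 (map suc (std w))
std-insertions a w w>a = begin
  map std (insertions a w)
    ≡⟨ LP.map-cong-local (All.tabulate (λ l∈ → LP.map-cong-local (All.tabulate (λ {x} _ →
         cong suc (count<-↭ x (insertions-↭ w l∈)))))) ⟩
  map (map (rank (a ∷ w))) (insertions a w)
    ≡⟨ map-insertions (rank (a ∷ w)) a w ⟩
  insertions (rank (a ∷ w) a) (map (rank (a ∷ w)) w)
    ≡⟨ cong₂ insertions (proj₁ std-a∷w) (proj₂ std-a∷w) ⟩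
  insertions 1 (map suc (std w)) ∎
  where
  open ≡-Reasoning
  std-a∷w = LP.∷-injective (std-∷-min a w w>a)

std-tail-insertion-∈-perms : ∀ n {ρ σ} → ρ ∈ perms (suc n) → std (tail' ρ) ∈ perms n →
  σ ∈ insertions 1 (map suc ρ) → std (tail' σ) ∈ perms (suc n)
std-tail-insertion-∈-perms n {[]}     ρ∈ _ _ = ⊥-elim (NP.0≢1+n (length-∈-perms (suc n) ρ∈))
std-tail-insertion-∈-perms n {x ∷ ρt} ρ∈ _ (here refl) =
  subst (_∈ perms (suc n)) (sym (trans (std-map-suc (x ∷ ρt)) (std-perm (suc n) ρ∈))) ρ∈
std-tail-insertion-∈-perms n {x ∷ ρt} ρ∈ stdρt∈ (there σ∈) with ∈-map⁻ (suc x ∷_) σ∈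
... | l , l∈ , refl = ∈-perms-suc⁺ n stdρt∈ (subst (std l ∈_) std-l∈ (∈-map⁺ std l∈))
  where
  ρt>1 : Above 2 (map suc ρt)
  ρt>1 y∈ with ∈-map⁻ suc y∈
  ... | z , z∈ , refl = s≤s (proj₁ (∈-perms-bounds (suc n) ρ∈ (there z∈)))
  std-l∈ : map std (insertions 1 (map suc ρt)) ≡ insertions 1 (map suc (std ρt))
  std-l∈ = trans (std-insertions 1 (map suc ρt) ρt>1) (cong (insertions 1 ∘ map suc) (std-map-suc ρt))

std-tail-∈-perms : ∀ n {σ} → σ ∈ perms n → std (tail' σ) ∈ perms (ℕ.pred n)
std-tail-∈-perms zero          (here refl) = here refl
std-tail-∈-perms (suc zero)    (here refl) = here refl
std-tail-∈-perms (suc zero)    (there ())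
std-tail-∈-perms (suc (suc n)) σ∈ =
  let ρ , ρ∈ , σ∈ρ = ∈-perms-suc⁻ (suc n) σ∈ in std-tail-insertion-∈-perms n ρ∈ (std-tail-∈-perms (suc n) ρ∈) σ∈ρ

std-drop-∈-perms : ∀ r n {σ} → σ ∈ perms n → std (drop r σ) ∈ perms (n ∸ r)
std-drop-∈-perms zero    n {σ} σ∈ = subst (_∈ perms n) (sym (std-perm n σ∈)) σ∈
std-drop-∈-perms (suc r) n {[]} σ∈ = subst (λ m → [] ∈ perms (m ∸ suc r)) (length-∈-perms n σ∈) (here refl)
std-drop-∈-perms (suc r) n {x ∷ σ} σ∈ =
  subst₂ (λ l m → l ∈ perms m) (std-drop-std r σ) (NP.∸-+-assoc n 1 r) (std-drop-∈-perms r (ℕ.pred n) (std-tail-∈-perms n σ∈))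

-- The two patterns of f_τ

F : List ℕ → List ℕ → List ℕ → ℚ
F T₁ T₂ s = if eqL s T₁ then 1ℚ else if eqL s T₂ then - 1ℚ else 0ℚ

record CancellingPair (T₁ T₂ : List ℕ) : Set where
  field
    R             : List ℕ
    1∉R           : 1 ∉ R
    T₂≡1∷R        : T₂ ≡ 1 ∷ R
    T₁∈insertions : T₁ ∈ insertions 1 R
    T₁≢T₂         : T₁ ≢ T₂

F-split : ∀ T₁ T₂ s → T₁ ≢ T₂ → F T₁ T₂ s ≡ indicator (eqL T₁ s) * 1ℚ + indicator (eqL T₂ s) * - 1ℚ
F-split T₁ T₂ s T₁≢T₂ with LP.≡-dec ℕ._≟_ s T₁ | LP.≡-dec ℕ._≟_ s T₂
... | yes refl | _        =
  sym (trans (cong₂ _+_ (indicator-refl s 1ℚ) (indicator-≢ (- 1ℚ) (T₁≢T₂ ∘ sym))) (QP.+-identityʳ 1ℚ))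
... | no s≢T₁  | yes refl =
  sym (trans (cong₂ _+_ (indicator-≢ 1ℚ (s≢T₁ ∘ sym)) (indicator-refl s (- 1ℚ))) (QP.+-identityˡ (- 1ℚ)))
... | no s≢T₁  | no s≢T₂  =
  sym (trans (cong₂ _+_ (indicator-≢ 1ℚ (s≢T₁ ∘ sym)) (indicator-≢ (- 1ℚ) (s≢T₂ ∘ sym))) (QP.+-identityˡ 0ℚ))

module _ {T₁ T₂ : List ℕ} (pair : CancellingPair T₁ T₂) where
  open CancellingPair pair

  sum-F-insertions : ∀ X → 1 ∉ X → sumQ (map (F T₁ T₂) (insertions 1 X)) ≡ 0ℚ
  sum-F-insertions X 1∉X = begin
    sumQ (map (F T₁ T₂) L)
      ≡⟨ sumQ-cong _ _ L (λ s _ → F-split T₁ T₂ s T₁≢T₂) ⟩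
    sumQ (map (λ s → indicator (eqL T₁ s) * 1ℚ + indicator (eqL T₂ s) * - 1ℚ) L)
      ≡⟨ sumQ-+ _ _ L ⟩
    Σ₁ + Σ₂
      ≡⟨ both (LP.≡-dec ℕ._≟_ X R) ⟩
    0ℚ ∎
    where
    open ≡-Reasoning
    L  = insertions 1 X
    Σ₁ = sumQ (map (λ s → indicator (eqL T₁ s) * 1ℚ) L)
    Σ₂ = sumQ (map (λ s → indicator (eqL T₂ s) * - 1ℚ) L)
    T₂∈insertions : T₂ ∈ insertions 1 R
    T₂∈insertions = subst (_∈ insertions 1 R) (sym T₂≡1∷R) (head∈insertions 1 R)
    both : Dec (X ≡ R) → Σ₁ + Σ₂ ≡ 0ℚ
    both (yes refl) = trans (cong₂ _+_ (sumQ-indicator T₁ _ L (insertions-unique X 1∉X) T₁∈insertions)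
                                       (sumQ-indicator T₂ _ L (insertions-unique X 1∉X) T₂∈insertions))
                            (QP.+-inverseʳ 1ℚ)
    both (no X≢R)   = trans (cong₂ _+_ (sumQ-indicator-∉ T₁ _ L (λ T₁∈L → X≢R (insertions-injective 1∉X 1∉R T₁∈L T₁∈insertions)))
                                       (sumQ-indicator-∉ T₂ _ L (λ T₂∈L → X≢R (insertions-injective 1∉X 1∉R T₂∈L T₂∈insertions))))
                            (QP.+-identityˡ 0ℚ)

  F-[] : F T₁ T₂ [] ≡ 0ℚ
  F-[] = cong₂ (λ b c → if b then 1ℚ else if c then - 1ℚ else 0ℚ) (eqL-≢ []≢T₁) (eqL-≢ []≢T₂)
    where
    []≢T₁ : [] ≢ T₁
    []≢T₁ refl with ∈-insertions⁻ R T₁∈insertions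
    ... | []    , _ , _ , ()
    ... | _ ∷ _ , _ , _ , ()
    []≢T₂ : [] ≢ T₂
    []≢T₂ []≡T₂ with trans []≡T₂ T₂≡1∷R
    ... | ()

Balanced : (List ℕ → ℚ) → Set
Balanced g = ∀ a w → Above (suc a) w → sumQ (map g (insertions a w)) ≡ 0ℚ

F-std-balanced : ∀ {T₁ T₂} → CancellingPair T₁ T₂ → Balanced (F T₁ T₂ ∘ std)
F-std-balanced {T₁} {T₂} pair a w w>a = begin
  sumQ (map (F T₁ T₂ ∘ std) (insertions a w))
    ≡⟨ cong sumQ (LP.map-∘ (insertions a w)) ⟩
  sumQ (map (F T₁ T₂) (map std (insertions a w)))
    ≡⟨ cong (sumQ ∘ map (F T₁ T₂)) (std-insertions a w w>a) ⟩
  sumQ (map (F T₁ T₂) (insertions 1 (map suc (std w))))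
    ≡⟨ sum-F-insertions pair _ (1∉map-suc-std w) ⟩
  0ℚ ∎
  where open ≡-Reasoning

ℕtoℚ-suc-* : ∀ k A → ℕtoℚ (suc k) * A ≡ A + ℕtoℚ k * A
ℕtoℚ-suc-* k A = begin
  ℕtoℚ (suc k) * A         ≡⟨ cong (_* A) (ℕtoℚ-homo-+ 1 k) ⟩
  (1ℚ + ℕtoℚ k) * A        ≡⟨ QP.*-distribʳ-+ A 1ℚ (ℕtoℚ k) ⟩
  1ℚ * A + ℕtoℚ k * A      ≡⟨ cong (_+ ℕtoℚ k * A) (QP.*-identityˡ A) ⟩
  A + ℕtoℚ k * A           ∎
  where open ≡-Reasoning

pred-∸ : ∀ j r → ℕ.pred j ∸ r ≡ j ∸ suc r
pred-∸ zero    r = NP.0∸n≡0 r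
pred-∸ (suc j) r = refl

*-pred-P′ : ∀ j r → j ℕ.* (ℕ.pred j P′ r) ≡ j P′ suc r
*-pred-P′ zero    r = cong (ℕ._* (0 P′ r)) (sym (NP.0∸n≡0 r))
*-pred-P′ (suc j) r = sym (nP′k≡n[n∸1P′k∸1] (suc j) (suc r))

-- The hypothesis on `g []` handles a j beyond the end of the word.
module _ {g : List ℕ → ℚ} (g[]≡0 : g [] ≡ 0ℚ) (balanced : Balanced g) where

  sum-insertions-drop : ∀ j a w → Above (suc a) w →
    sumQ (map (λ l → g (drop j l)) (insertions a w)) ≡ ℕtoℚ j * g (drop (ℕ.pred j) w)
  sum-insertions-drop zero    a w       w>a = trans (balanced a w w>a) (sym (QP.*-zeroˡ (g w)))
  sum-insertions-drop (suc j) a []      _   = begin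
    g (drop j []) + 0ℚ              ≡⟨ QP.+-identityʳ (g (drop j [])) ⟩
    g (drop j [])                   ≡⟨ cong g (LP.drop-[] j) ⟩
    g []                            ≡⟨ g[]≡0 ⟩
    0ℚ                              ≡⟨ QP.*-zeroʳ (ℕtoℚ (suc j)) ⟨
    ℕtoℚ (suc j) * 0ℚ               ≡⟨ cong (ℕtoℚ (suc j) *_) g[]≡0 ⟨
    ℕtoℚ (suc j) * g []             ≡⟨ cong (λ l → ℕtoℚ (suc j) * g l) (LP.drop-[] j) ⟨
    ℕtoℚ (suc j) * g (drop j [])    ∎
    where open ≡-Reasoning
  sum-insertions-drop (suc j) a (y ∷ w) w>a = begin
    g (drop j (y ∷ w)) + sumQ (map (λ l → g (drop (suc j) l)) (map (y ∷_) (insertions a w)))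
      ≡⟨ cong (λ s → g (drop j (y ∷ w)) + sumQ s) (LP.map-∘ (insertions a w)) ⟨
    g (drop j (y ∷ w)) + sumQ (map (λ l → g (drop j l)) (insertions a w))
      ≡⟨ cong (g (drop j (y ∷ w)) +_) (sum-insertions-drop j a w (w>a ∘ there)) ⟩
    g (drop j (y ∷ w)) + ℕtoℚ j * g (drop (ℕ.pred j) w)
      ≡⟨ cong (g (drop j (y ∷ w)) +_) (drop-pred j) ⟩
    g (drop j (y ∷ w)) + ℕtoℚ j * g (drop j (y ∷ w))
      ≡⟨ ℕtoℚ-suc-* j (g (drop j (y ∷ w))) ⟨
    ℕtoℚ (suc j) * g (drop j (y ∷ w))
      ∎
    where
    open ≡-Reasoning
    drop-pred : ∀ j → ℕtoℚ j * g (drop (ℕ.pred j) w) ≡ ℕtoℚ j * g (drop j (y ∷ w))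
    drop-pred zero    = trans (QP.*-zeroˡ (g w)) (sym (QP.*-zeroˡ (g (y ∷ w))))
    drop-pred (suc j) = refl

  sum-insertionsRun-drop : ∀ r a Z j → Above (a ℕ.+ r) Z →
    sumQ (map (λ y → g (drop j y)) (insertionsRun a r Z)) ≡ ℕtoℚ (j P′ r) * g (drop (j ∸ r) Z)
  sum-insertionsRun-drop zero    a Z j _  = trans (QP.+-identityʳ (g (drop j Z))) (sym (QP.*-identityˡ (g (drop j Z))))
  sum-insertionsRun-drop (suc r) a Z j Z≥ = begin
    sumQ (map (λ y → g (drop j y)) (concatMap (insertions a) W))
      ≡⟨ sumQ-concatMap (λ y → g (drop j y)) (insertions a) W ⟩
    sumQ (map (λ w → sumQ (map (λ l → g (drop j l)) (insertions a w))) W)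
      ≡⟨ sumQ-cong _ _ W (λ w w∈ → sum-insertions-drop j a w (insertionsRun-Above (suc a) r Z Z≥′ w∈)) ⟩
    sumQ (map (λ w → ℕtoℚ j * g (drop (ℕ.pred j) w)) W)
      ≡⟨ sumQ-*ˡ (ℕtoℚ j) (λ w → g (drop (ℕ.pred j) w)) W ⟩
    ℕtoℚ j * sumQ (map (λ w → g (drop (ℕ.pred j) w)) W)
      ≡⟨ cong (ℕtoℚ j *_) (sum-insertionsRun-drop r (suc a) Z (ℕ.pred j) Z≥′) ⟩
    ℕtoℚ j * (ℕtoℚ (ℕ.pred j P′ r) * g (drop (ℕ.pred j ∸ r) Z))
      ≡⟨ QP.*-assoc (ℕtoℚ j) _ _ ⟨
    ℕtoℚ j * ℕtoℚ (ℕ.pred j P′ r) * g (drop (ℕ.pred j ∸ r) Z)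
      ≡⟨ cong₂ _*_ (trans (sym (ℕtoℚ-homo-* j _)) (cong ℕtoℚ (*-pred-P′ j r))) (cong (g ∘ (λ i → drop i Z)) (pred-∸ j r)) ⟩
    ℕtoℚ (j P′ suc r) * g (drop (j ∸ suc r) Z)
      ∎
    where
    open ≡-Reasoning
    W = insertionsRun (suc a) r Z
    Z≥′ : Above (suc a ℕ.+ r) Z
    Z≥′ = Above-suc a r Z≥

pattern-pair : ∀ a D → Unique D → a ∈ D → Above a D → (∀ {x rest} → D ≡ x ∷ rest → x ≢ a) →
  CancellingPair (std D) (std (a ∷ filter (λ v → ¬? (v ℕ.≟ a)) D))
pattern-pair a (d ∷ D′) uD (here refl)  D≥a head≢a = ⊥-elim (head≢a refl refl)
pattern-pair a (d ∷ D′) uD (there a∈D′) D≥a _ with ∈-∃++ a∈D′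
... | u′ , v , refl = record
  { R             = R
  ; 1∉R           = 1∉map-suc-std (u ++ v)
  ; T₂≡1∷R        = T₂≡1∷R
  ; T₁∈insertions = subst (std D ∈_) (std-insertions a (u ++ v) u++v>a) (∈-map⁺ std (∈-insertions⁺ a u v))
  ; T₁≢T₂         = λ T₁≡T₂ → head≢1 (proj₁ (LP.∷-injective (trans T₁≡T₂ T₂≡1∷R)))
  }
  where
  u = d ∷ u′
  R = map suc (std (u ++ v))
  D = u ++ a ∷ v
  a∉u++v : a ∉ u ++ v
  a∉u++v = UniqueP.Unique[x∷xs]⇒x∉xs (Unique-↭ (PermP.shift a u v) uD)
  u++v>a : Above (suc a) (u ++ v)
  u++v>a {x} x∈ = NP.≤∧≢⇒< (D≥a (PermP.∈-resp-↭ (↭-sym (PermP.shift a u v)) (there x∈))) λ { refl → a∉u++v x∈ }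
  ≢a? : Decidable (_≢ a)
  ≢a? v = ¬? (v ℕ.≟ a)
  filter≡u++v : filter ≢a? D ≡ u ++ v
  filter≡u++v = begin
    filter ≢a? D
      ≡⟨ LP.filter-++ ≢a? u (a ∷ v) ⟩
    filter ≢a? u ++ filter ≢a? (a ∷ v)
      ≡⟨ cong₂ _++_ (LP.filter-all ≢a? (All.tabulate (λ x∈ → ≢a (∈-++⁺ˡ x∈))))
           (trans (LP.filter-reject ≢a? (λ a≢a → a≢a refl)) (LP.filter-all ≢a? (All.tabulate (λ x∈ → ≢a (∈-++⁺ʳ u x∈))))) ⟩
    u ++ v ∎
    where
    open ≡-Reasoning
    ≢a : ∀ {x} → x ∈ u ++ v → x ≢ a
    ≢a x∈ refl = a∉u++v x∈
  T₂≡1∷R : std (a ∷ filter ≢a? D) ≡ 1 ∷ R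
  T₂≡1∷R = trans (cong (λ w → std (a ∷ w)) filter≡u++v) (std-∷-min a (u ++ v) u++v>a)
  head≢1 : rank D d ≢ 1
  head≢1 rank≡1 = NP.<-irrefl (sym (NP.suc-injective rank≡1))
    (NP.≤-<-trans z≤n (count<-strict D (∈-++⁺ʳ u (here refl)) (u++v>a (here refl))))

fixedPrefix-yes : ∀ k xs → fixedPrefix k (k ∷ xs) ≡ suc (fixedPrefix (suc k) xs)
fixedPrefix-yes k xs = cong (λ b → if b then suc (fixedPrefix (suc k) xs) else 0) (dec-true (k ℕ.≟ k) refl)

fixedPrefix-no : ∀ {k x} xs → x ≢ k → fixedPrefix k (x ∷ xs) ≡ 0
fixedPrefix-no {k} {x} xs x≢k = cong (λ b → if b then suc (fixedPrefix (suc k) xs) else 0) (dec-false (x ℕ.≟ k) x≢k)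

fixedPrefix-split : ∀ k l → l ≡ interval k (fixedPrefix k l) ++ drop (fixedPrefix k l) l
fixedPrefix-split k []       = refl
fixedPrefix-split k (x ∷ xs) with x ℕ.≟ k
... | yes refl rewrite fixedPrefix-yes k xs = cong (k ∷_) (fixedPrefix-split (suc k) xs)
... | no x≢k   rewrite fixedPrefix-no xs x≢k = refl

fixedPrefix-maximal : ∀ k l {x rest} → drop (fixedPrefix k l) l ≡ x ∷ rest → x ≢ k ℕ.+ fixedPrefix k l
fixedPrefix-maximal k []       ()
fixedPrefix-maximal k (y ∷ xs) drop≡ with y ℕ.≟ k
... | yes refl rewrite fixedPrefix-yes k xs = λ x≡ → fixedPrefix-maximal (suc k) xs drop≡ (trans x≡ (NP.+-suc k _))
... | no y≢k   rewrite fixedPrefix-no xs y≢k = λ x≡ → y≢k (trans (proj₁ (LP.∷-injective drop≡)) (trans x≡ (NP.+-identityʳ k)))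

fixedPrefix-map-suc : ∀ k l → fixedPrefix (suc k) (map suc l) ≡ fixedPrefix k l
fixedPrefix-map-suc k []       = refl
fixedPrefix-map-suc k (x ∷ xs) = cong (λ j → if does (x ℕ.≟ k) then suc j else 0) (fixedPrefix-map-suc (suc k) xs)

jOf-1∷map-suc : ∀ ρ → jOf (1 ∷ map suc ρ) ≡ suc (jOf ρ)
jOf-1∷map-suc ρ = trans (fixedPrefix-yes 1 (map suc ρ)) (cong suc (fixedPrefix-map-suc 1 ρ))

++-cancelˡ-↭ : ∀ (xs : List ℕ) {ys zs} → xs ++ ys ↭ xs ++ zs → ys ↭ zs
++-cancelˡ-↭ []       ys↭zs = ys↭zs
++-cancelˡ-↭ (x ∷ xs) p     = ++-cancelˡ-↭ xs (PermP.drop-∷ p)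

jOf-≤ : ∀ n {τ} → τ ∈ perms n → jOf τ ≤ n
jOf-≤ n {τ} τ∈ = subst (jOf τ ≤_) ∣τ∣≡n (NP.m≤m+n (jOf τ) _)
  where
  ∣τ∣≡n : jOf τ ℕ.+ length (drop (jOf τ) τ) ≡ n
  ∣τ∣≡n = begin
    jOf τ ℕ.+ length (drop (jOf τ) τ)
      ≡⟨ cong (ℕ._+ length (drop (jOf τ) τ)) (length-interval 1 (jOf τ)) ⟨
    length (interval 1 (jOf τ)) ℕ.+ length (drop (jOf τ) τ)
      ≡⟨ LP.length-++ (interval 1 (jOf τ)) ⟨
    length (interval 1 (jOf τ) ++ drop (jOf τ) τ)
      ≡⟨ cong length (fixedPrefix-split 1 τ) ⟨
    length τ
      ≡⟨ length-∈-perms n τ∈ ⟩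
    n ∎
    where open ≡-Reasoning

drop-jOf-↭ : ∀ n {τ} → τ ∈ perms n → drop (jOf τ) τ ↭ interval (suc (jOf τ)) (n ∸ jOf τ)
drop-jOf-↭ n {τ} τ∈ = ++-cancelˡ-↭ (interval 1 j) (subst₂ _↭_ (fixedPrefix-split 1 τ) interval≡ (∈-perms⇒↭ n τ∈))
  where
  j = jOf τ
  interval≡ : interval 1 n ≡ interval 1 j ++ interval (suc j) (n ∸ j)
  interval≡ = trans (cong (interval 1) (sym (NP.m+[n∸m]≡n (jOf-≤ n τ∈)))) (sym (interval-++ 1 j (n ∸ j)))

pattern₁ : ℕ → List ℕ → List ℕ
pattern₁ j τ = std (drop j τ)

pattern₂ : ℕ → List ℕ → List ℕ
pattern₂ j τ = std (suc j ∷ filter (λ v → ¬? (v ℕ.≟ suc j)) (drop j τ))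

fτ-id : ∀ n τ σ → jOf τ ≡ n → fτ n τ σ ≡ 1ℚ
fτ-id n τ σ j≡n rewrite dec-true (jOf τ ℕ.≟ n) j≡n = refl

fτ-F : ∀ n τ σ → jOf τ ≢ n → fτ n τ σ ≡ F (pattern₁ (jOf τ) τ) (pattern₂ (jOf τ) τ) (std (drop (jOf τ) σ))
fτ-F n τ σ j≢n rewrite dec-false (jOf τ ℕ.≟ n) j≢n = refl

fτ-pair : ∀ n {τ} → τ ∈ perms n → jOf τ ≢ n → CancellingPair (pattern₁ (jOf τ) τ) (pattern₂ (jOf τ) τ)
fτ-pair n {τ} τ∈ j≢n = pattern-pair (suc j) (drop j τ) (UniqueP.drop⁺ j (∈-perms⇒Unique n τ∈)) 1+j∈ drop≥1+j
  (fixedPrefix-maximal 1 τ)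
  where
  j = jOf τ
  n∸j≡ : n ∸ j ≡ suc (n ∸ suc j)
  n∸j≡ = NP.+-∸-assoc 1 (NP.≤∧≢⇒< (jOf-≤ n τ∈) j≢n)
  1+j∈ : suc j ∈ drop j τ
  1+j∈ = PermP.∈-resp-↭ (↭-sym (drop-jOf-↭ n τ∈)) (subst (λ k → suc j ∈ interval (suc j) k) (sym n∸j≡) (here refl))
  drop≥1+j : Above (suc j) (drop j τ)
  drop≥1+j x∈ = proj₁ (∈-interval⁻ (PermP.∈-resp-↭ (drop-jOf-↭ n τ∈) x∈))

-- Eigenfunctions

P′-< : ∀ j r → j < r → j P′ r ≡ 0
P′-< j (suc r) (s≤s j≤r) = cong (ℕ._* (j P′ r)) (NP.m≤n⇒m∸n≡0 j≤r)

std-drop-shifted : ∀ r i σ → r ≤ i → std (drop (i ∸ r) (map (r ℕ.+_) (std (drop r σ)))) ≡ std (drop i σ)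
std-drop-shifted r i σ r≤i = begin
  std (drop (i ∸ r) (map (r ℕ.+_) (std (drop r σ))))   ≡⟨ cong std (LP.drop-map (i ∸ r) (std (drop r σ))) ⟩
  std (map (r ℕ.+_) (drop (i ∸ r) (std (drop r σ))))   ≡⟨ std-map-+ r _ ⟩
  std (drop (i ∸ r) (std (drop r σ)))                  ≡⟨ std-drop-std (i ∸ r) (drop r σ) ⟩
  std (drop (i ∸ r) (drop r σ))                        ≡⟨ cong std (LP.drop-drop r (i ∸ r) σ) ⟩
  std (drop (r ℕ.+ (i ∸ r)) σ)                         ≡⟨ cong (λ k → std (drop k σ)) (NP.m+[n∸m]≡n r≤i) ⟩
  std (drop i σ)                                       ∎
  where open ≡-Reasoning

sum-fτ-insertionsRun : ∀ n r {τ σ} → τ ∈ perms n → σ ∈ perms n → r ≤ n →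
  sumQ (map (fτ n τ) (insertionsRun 1 r (map (r ℕ.+_) (std (drop r σ))))) ≡ ℕtoℚ (jOf τ P′ r) * fτ n τ σ
sum-fτ-insertionsRun n r {τ} {σ} τ∈ σ∈ r≤n with jOf τ ℕ.≟ n
... | yes j≡n = begin
  sumQ (map (fτ n τ) Ys)             ≡⟨ sumQ-cong _ _ Ys (λ y _ → fτ-id n τ y j≡n) ⟩
  sumQ (map (λ _ → 1ℚ) Ys)           ≡⟨ sumQ-const-1 Ys ⟩
  ℕtoℚ (length Ys)                   ≡⟨ cong ℕtoℚ (length-insertionsRun 1 r Z) ⟩
  ℕtoℚ ((length Z ℕ.+ r) P′ r)       ≡⟨ cong (λ m → ℕtoℚ (m P′ r)) (trans ∣Z∣+r≡n (sym j≡n)) ⟩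
  ℕtoℚ (jOf τ P′ r)                  ≡⟨ QP.*-identityʳ (ℕtoℚ (jOf τ P′ r)) ⟨
  ℕtoℚ (jOf τ P′ r) * 1ℚ             ≡⟨ cong (ℕtoℚ (jOf τ P′ r) *_) (fτ-id n τ σ j≡n) ⟨
  ℕtoℚ (jOf τ P′ r) * fτ n τ σ       ∎
  where
  open ≡-Reasoning
  Z  = map (r ℕ.+_) (std (drop r σ))
  Ys = insertionsRun 1 r Z
  ∣Z∣+r≡n : length Z ℕ.+ r ≡ n
  ∣Z∣+r≡n = trans (cong (ℕ._+ r) (trans (LP.length-map (r ℕ.+_) (std (drop r σ)))
                                         (length-∈-perms (n ∸ r) (std-drop-∈-perms r n σ∈))))
                  (trans (NP.+-comm (n ∸ r) r) (NP.m+[n∸m]≡n r≤n))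
... | no j≢n = begin
  sumQ (map (fτ n τ) Ys)
    ≡⟨ sumQ-cong _ _ Ys (λ y _ → fτ-F n τ y j≢n) ⟩
  sumQ (map (λ y → g (drop j y)) Ys)
    ≡⟨ sum-insertionsRun-drop (F-[] pair) (F-std-balanced pair) r 1 Z j Z>r ⟩
  ℕtoℚ (j P′ r) * g (drop (j ∸ r) Z)
    ≡⟨ compare (r ℕ.≤? j) ⟩
  ℕtoℚ (j P′ r) * g (drop j σ)
    ≡⟨ cong (ℕtoℚ (j P′ r) *_) (fτ-F n τ σ j≢n) ⟨
  ℕtoℚ (j P′ r) * fτ n τ σ ∎
  where
  open ≡-Reasoning
  j    = jOf τ
  pair = fτ-pair n τ∈ j≢n
  g    = F (pattern₁ j τ) (pattern₂ j τ) ∘ std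
  Z    = map (r ℕ.+_) (std (drop r σ))
  Ys   = insertionsRun 1 r Z
  Z>r : Above (1 ℕ.+ r) Z
  Z>r = Above-shift-perm r (n ∸ r) (std-drop-∈-perms r n σ∈)
  compare : Dec (r ≤ j) → ℕtoℚ (j P′ r) * g (drop (j ∸ r) Z) ≡ ℕtoℚ (j P′ r) * g (drop j σ)
  compare (yes r≤j) = cong (λ s → ℕtoℚ (j P′ r) * F (pattern₁ j τ) (pattern₂ j τ) s) (std-drop-shifted r j σ r≤j)
  compare (no  r≰j) rewrite P′-< j r (NP.≰⇒> r≰j) = trans (QP.*-zeroˡ (g (drop (j ∸ r) Z))) (sym (QP.*-zeroˡ (g (drop j σ))))

sum-fτ-insertions : ∀ n {τ σ} → τ ∈ perms n → σ ∈ perms n → 1 ≤ n →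
  sumQ (map (fτ n τ) (insertions 1 (map suc (std (tail' σ))))) ≡ ℕtoℚ (jOf τ) * fτ n τ σ
sum-fτ-insertions n {τ} {σ} τ∈ σ∈ 1≤n = begin
  sumQ (map (fτ n τ) (insertions 1 Z))
    ≡⟨ cong (sumQ ∘ map (fτ n τ)) (LP.++-identityʳ (insertions 1 Z)) ⟨
  sumQ (map (fτ n τ) (insertions 1 Z ++ []))
    ≡⟨ cong (λ l → sumQ (map (fτ n τ) (insertions 1 (map suc (std l)) ++ []))) (drop-1 σ) ⟨
  sumQ (map (fτ n τ) (insertionsRun 1 1 (map suc (std (drop 1 σ)))))
    ≡⟨ sum-fτ-insertionsRun n 1 τ∈ σ∈ 1≤n ⟩
  ℕtoℚ (jOf τ P′ 1) * fτ n τ σ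
    ≡⟨ cong (λ m → ℕtoℚ m * fτ n τ σ) (NP.*-identityʳ (jOf τ)) ⟩
  ℕtoℚ (jOf τ) * fτ n τ σ ∎
  where
  open ≡-Reasoning
  Z = map suc (std (tail' σ))
  drop-1 : ∀ σ → drop 1 σ ≡ tail' σ
  drop-1 []      = refl
  drop-1 (_ ∷ _) = refl

sum-indicators : ∀ {ys} ts (f : List ℕ → ℚ) → Unique ys → (∀ {t} → t ∈ ts → t ∈ ys) →
  sumQ (map (λ y → sumQ (map (λ t → indicator (eqL t y)) ts) * f y) ys) ≡ sumQ (map f ts)
sum-indicators {ys} ts f uys ts⊆ys = begin
  sumQ (map (λ y → sumQ (map (λ t → indicator (eqL t y)) ts) * f y) ys)
    ≡⟨ sumQ-cong _ _ ys (λ y _ → sumQ-*ʳ (λ t → indicator (eqL t y)) (f y) ts) ⟨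
  sumQ (map (λ y → sumQ (map (λ t → indicator (eqL t y) * f y) ts)) ys)
    ≡⟨ sumQ-swap (λ y t → indicator (eqL t y) * f y) ys ts ⟩
  sumQ (map (λ t → sumQ (map (λ y → indicator (eqL t y) * f y) ys)) ts)
    ≡⟨ sumQ-cong _ _ ts (λ t t∈ → sumQ-indicator t f ys uys (ts⊆ys t∈)) ⟩
  sumQ (map f ts) ∎
  where open ≡-Reasoning

top-to-random-eigen : ∀ n {τ σ} → τ ∈ perms (suc n) → σ ∈ perms (suc n) →
  applyK (suc n) (Ktop (suc n)) (fτ (suc n) τ) σ ≡ (ℕtoℚ (jOf τ) * inv (suc n)) * fτ (suc n) τ σ
top-to-random-eigen n {τ} {σ} τ∈ σ∈ = begin
  applyK (suc n) (Ktop (suc n)) f σ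
    ≡⟨ sumQ-cong _ _ (perms (suc n)) (λ y _ → cong (λ s → (inv (suc n) * sumQ s) * f y)
         (LP.map-∘ {g = λ t → indicator (eqL t y)} {f = λ k → insertAt k 1 w} (upTo (suc n)))) ⟩
  sumQ (map (λ y → (inv (suc n) * sumQ (map (λ t → indicator (eqL t y)) ts)) * f y) (perms (suc n)))
    ≡⟨ sumQ-cong _ _ (perms (suc n)) (λ y _ → QP.*-assoc (inv (suc n)) _ (f y)) ⟩
  sumQ (map (λ y → inv (suc n) * (sumQ (map (λ t → indicator (eqL t y)) ts) * f y)) (perms (suc n)))
    ≡⟨ sumQ-*ˡ (inv (suc n)) _ (perms (suc n)) ⟩
  inv (suc n) * sumQ (map (λ y → sumQ (map (λ t → indicator (eqL t y)) ts) * f y) (perms (suc n)))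
    ≡⟨ cong (inv (suc n) *_) (sum-indicators ts f (perms-unique (suc n)) ts⊆perms) ⟩
  inv (suc n) * sumQ (map f ts)
    ≡⟨ cong (λ l → inv (suc n) * sumQ (map f l)) insertions≡ts ⟨
  inv (suc n) * sumQ (map f (insertions 1 w))
    ≡⟨ cong (inv (suc n) *_) (sum-fτ-insertions (suc n) τ∈ σ∈ (s≤s z≤n)) ⟩
  inv (suc n) * (ℕtoℚ (jOf τ) * f σ)
    ≡⟨ solve 3 (λ i j x → i :* (j :* x) := (j :* i) :* x) refl (inv (suc n)) (ℕtoℚ (jOf τ)) (f σ) ⟩
  (ℕtoℚ (jOf τ) * inv (suc n)) * f σ
    ∎
  where
  open ≡-Reasoning
  f        = fτ (suc n) τ
  stdtail∈ = std-tail-∈-perms (suc n) σ∈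
  w        = map suc (std (tail' σ))
  ts       = map (λ k → insertAt k 1 w) (upTo (suc n))
  insertions≡ts : insertions 1 w ≡ ts
  insertions≡ts = trans (insertions≡map-insertAt 1 w) (cong (λ m → map (λ k → insertAt k 1 w) (upTo (suc m)))
    (trans (LP.length-map suc (std (tail' σ))) (length-∈-perms n stdtail∈)))
  ts⊆perms : ∀ {t} → t ∈ ts → t ∈ perms (suc n)
  ts⊆perms t∈ = ∈-perms-suc⁺ n stdtail∈ (subst (_ ∈_) (sym insertions≡ts) t∈)

sum-fibre : ∀ n r {ρ₀} → r ≤ n → ρ₀ ∈ perms (n ∸ r) → (g : List ℕ → ℚ) →
  sumQ (map (λ y → indicator (eqL (filter (r ℕ.<?_) y) (map (r ℕ.+_) ρ₀)) * g y) (perms n))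
  ≡ sumQ (map g (insertionsRun 1 r (map (r ℕ.+_) ρ₀)))
sum-fibre n r {ρ₀} r≤n ρ₀∈ g = begin
  sumQ (map G (perms n))
    ≡⟨ cong (λ m → sumQ (map G (perms m))) (NP.m+[n∸m]≡n r≤n) ⟨
  sumQ (map G (perms (r ℕ.+ k)))
    ≡⟨ sumQ-↭ G (perms↭permsSplit r k) ⟩
  sumQ (map G (permsSplit r k))
    ≡⟨ sumQ-concatMap G Run (perms k) ⟩
  sumQ (map (λ ρ → sumQ (map G (Run ρ))) (perms k))
    ≡⟨ sumQ-cong _ _ (perms k) fibre ⟩
  sumQ (map (λ ρ → indicator (eqL ρ₀ ρ) * S ρ) (perms k))
    ≡⟨ sumQ-indicator ρ₀ S (perms k) (perms-unique k) ρ₀∈ ⟩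
  S ρ₀ ∎
  where
  open ≡-Reasoning
  k = n ∸ r
  Run : List ℕ → List (List ℕ)
  Run ρ = insertionsRun 1 r (map (r ℕ.+_) ρ)
  G : List ℕ → ℚ
  G y = indicator (eqL (filter (r ℕ.<?_) y) (map (r ℕ.+_) ρ₀)) * g y
  S : List ℕ → ℚ
  S ρ = sumQ (map g (Run ρ))
  fibre : ∀ ρ → ρ ∈ perms k → sumQ (map G (Run ρ)) ≡ indicator (eqL ρ₀ ρ) * S ρ
  fibre ρ ρ∈ = begin
    sumQ (map G (Run ρ))
      ≡⟨ sumQ-cong _ _ (Run ρ) (λ y y∈ →
           cong (λ z → indicator (eqL z (map (r ℕ.+_) ρ₀)) * g y)
           (filter-insertionsRun r 1 r _ (Above-shift-perm r k ρ∈) NP.≤-refl y∈)) ⟩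
    sumQ (map (λ y → indicator (eqL (map (r ℕ.+_) ρ) (map (r ℕ.+_) ρ₀)) * g y) (Run ρ))
      ≡⟨ sumQ-*ˡ (indicator (eqL (map (r ℕ.+_) ρ) (map (r ℕ.+_) ρ₀))) g (Run ρ) ⟩
    indicator (eqL (map (r ℕ.+_) ρ) (map (r ℕ.+_) ρ₀)) * S ρ
      ≡⟨ cong (λ b → indicator b * S ρ)
           (trans (eqL-injective (LP.map-injective (NP.+-cancelˡ-≡ r _ _)) ρ ρ₀) (eqL-sym ρ ρ₀)) ⟩
    indicator (eqL ρ₀ ρ) * S ρ ∎

sum-upTo-suc : ∀ (h : ℕ → ℚ) N → sumQ (map h (upTo (suc N))) ≡ h 0 + sumQ (map (h ∘ suc) (upTo N))
sum-upTo-suc h N = cong (λ rs → h 0 + sumQ rs) (trans (LP.map-applyUpTo suc h N) (sym (LP.map-upTo (h ∘ suc) N)))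

module Binomial (x y : ℚ) (x+y≡1 : x + y ≡ 1ℚ) where

  term : ℕ → ℕ → ℕ → ℚ
  term j N r = ℕtoℚ (j C r) * (x ^Q r) * (y ^Q (N ∸ r))

  S : ℕ → ℕ → ℚ
  S j N = sumQ (map (term j N) (upTo (suc N)))

  pascal : ∀ j N r → term (suc j) (suc N) (suc r) ≡ x * term j N r + term j (suc N) (suc r)
  pascal j N r = begin
    ℕtoℚ (suc j C suc r) * (x * X) * Y
      ≡⟨ cong (λ c → ℕtoℚ c * (x * X) * Y) (nCk+nC[k+1]≡[n+1]C[k+1] j r) ⟨
    ℕtoℚ (j C r ℕ.+ j C suc r) * (x * X) * Y
      ≡⟨ cong (λ c → c * (x * X) * Y) (ℕtoℚ-homo-+ (j C r) (j C suc r)) ⟩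
    (ℕtoℚ (j C r) + ℕtoℚ (j C suc r)) * (x * X) * Y
      ≡⟨ solve 5 (λ A B X′ XR YR → (A :+ B) :* (X′ :* XR) :* YR := X′ :* (A :* XR :* YR) :+ B :* (X′ :* XR) :* YR)
           refl (ℕtoℚ (j C r)) (ℕtoℚ (j C suc r)) x X Y ⟩
    x * term j N r + term j (suc N) (suc r) ∎
    where
    open ≡-Reasoning
    X = x ^Q r
    Y = y ^Q (N ∸ r)

  S-zero : ∀ N → S 0 N ≡ y ^Q N
  S-zero N = begin
    S 0 N
      ≡⟨ sum-upTo-suc (term 0 N) N ⟩
    1ℚ * 1ℚ * (y ^Q N) + sumQ (map (term 0 N ∘ suc) (upTo N))
      ≡⟨ cong (1ℚ * 1ℚ * (y ^Q N) +_) (sumQ-zero _ (upTo N) (λ r _ → 0*x*y≡0 r)) ⟩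
    1ℚ * 1ℚ * (y ^Q N) + 0ℚ
      ≡⟨ solve 1 (λ Y → con 1ℚ :* con 1ℚ :* Y :+ con 0ℚ := Y) refl (y ^Q N) ⟩
    y ^Q N ∎
    where
    open ≡-Reasoning
    0*x*y≡0 : ∀ r → 0ℚ * (x ^Q suc r) * (y ^Q (N ∸ suc r)) ≡ 0ℚ
    0*x*y≡0 r = trans (cong (_* (y ^Q (N ∸ suc r))) (QP.*-zeroˡ (x ^Q suc r))) (QP.*-zeroˡ (y ^Q (N ∸ suc r)))

  S-suc : ∀ j N → S (suc j) (suc N) ≡ x * S j N + S j (suc N)
  S-suc j N = begin
    S (suc j) (suc N)
      ≡⟨ sum-upTo-suc (term (suc j) (suc N)) (suc N) ⟩
    t₀ + sumQ (map (term (suc j) (suc N) ∘ suc) (upTo (suc N)))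
      ≡⟨ cong (t₀ +_) (sumQ-cong _ _ (upTo (suc N)) (λ r _ → pascal j N r)) ⟩
    t₀ + sumQ (map (λ r → x * term j N r + term j (suc N) (suc r)) (upTo (suc N)))
      ≡⟨ cong (t₀ +_) (sumQ-+ (λ r → x * term j N r) (term j (suc N) ∘ suc) (upTo (suc N))) ⟩
    t₀ + (sumQ (map (λ r → x * term j N r) (upTo (suc N))) + T)
      ≡⟨ cong (λ s → t₀ + (s + T)) (sumQ-*ˡ x (term j N) (upTo (suc N))) ⟩
    t₀ + (x * S j N + T)
      ≡⟨ solve 3 (λ A B C → A :+ (B :+ C) := B :+ (A :+ C)) refl t₀ (x * S j N) T ⟩
    x * S j N + (t₀ + T)
      ≡⟨ cong (x * S j N +_) (sum-upTo-suc (term j (suc N)) (suc N)) ⟨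
    x * S j N + S j (suc N) ∎
    where
    open ≡-Reasoning
    t₀ = term j (suc N) 0
    T  = sumQ (map (term j (suc N) ∘ suc) (upTo (suc N)))

  binomial : ∀ j N → j ≤ N → S j N ≡ y ^Q (N ∸ j)
  binomial zero    N       _         = S-zero N
  binomial (suc j) (suc N) (s≤s j≤N) = begin
    S (suc j) (suc N)
      ≡⟨ S-suc j N ⟩
    x * S j N + S j (suc N)
      ≡⟨ cong₂ (λ a b → x * a + b) (binomial j N j≤N) (binomial j (suc N) (NP.m≤n⇒m≤1+n j≤N)) ⟩
    x * y ^Q (N ∸ j) + y ^Q (suc N ∸ j)
      ≡⟨ cong (λ k → x * y ^Q (N ∸ j) + y ^Q k) (NP.+-∸-assoc 1 j≤N) ⟩
    x * y ^Q (N ∸ j) + y * y ^Q (N ∸ j)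
      ≡⟨ QP.*-distribʳ-+ (y ^Q (N ∸ j)) x y ⟨
    (x + y) * y ^Q (N ∸ j)
      ≡⟨ cong (_* y ^Q (N ∸ j)) x+y≡1 ⟩
    1ℚ * y ^Q (N ∸ j)
      ≡⟨ QP.*-identityˡ (y ^Q (N ∸ j)) ⟩
    y ^Q (N ∸ j) ∎
    where open ≡-Reasoning

P≡P′ : ∀ {r n} → r ≤ n → n P r ≡ n P′ r
P≡P′ {r} {n} r≤n = cong (λ b → if b then n P′ r else 0) (Equivalence.to BoolP.T-≡ (NP.≤⇒≤ᵇ r≤n))

P′≡C*! : ∀ {r n} → r ≤ n → n P′ r ≡ (n C r) ℕ.* (r ℕ.!)
P′≡C*! {r} {n} r≤n = sym (begin
  (n C r) ℕ.* r ℕ.!                          ≡⟨ cong (ℕ._* r ℕ.!) (nCk≡nPk/k! r≤n) ⟩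
  ((n P r) ℕ./ r ℕ.!) ℕ.* r ℕ.!              ≡⟨ cong (λ m → (m ℕ./ r ℕ.!) ℕ.* r ℕ.!) (P≡P′ r≤n) ⟩
  ((n P′ r) ℕ./ r ℕ.!) ℕ.* r ℕ.!             ≡⟨ m/n*n≡m (k!∣nP′k r≤n) ⟩
  n P′ r                                     ∎)
  where
  open ≡-Reasoning
  instance _ = r NP.!≢0

P′-nonZero : ∀ {r n} → r ≤ n → ℕ.NonZero (n P′ r)
P′-nonZero {zero}  _   = _
P′-nonZero {suc r} {n} r<n = NP.m*n≢0 (n ∸ r) (n P′ r) {{ℕ.>-nonZero (NP.m<n⇒0<n∸m r<n)}} {{P′-nonZero (NP.<⇒≤ r<n)}}

C*P′≡C*P : ∀ n j r → r ≤ n → (n C r) ℕ.* (j P′ r) ≡ (j C r) ℕ.* (n P r)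
C*P′≡C*P n j r r≤n with r ℕ.≤? j
... | yes r≤j = begin
  (n C r) ℕ.* (j P′ r)               ≡⟨ cong ((n C r) ℕ.*_) (P′≡C*! r≤j) ⟩
  (n C r) ℕ.* ((j C r) ℕ.* r ℕ.!)    ≡⟨ NP.*-assoc (n C r) (j C r) (r ℕ.!) ⟨
  (n C r) ℕ.* (j C r) ℕ.* r ℕ.!      ≡⟨ cong (ℕ._* r ℕ.!) (NP.*-comm (n C r) (j C r)) ⟩
  (j C r) ℕ.* (n C r) ℕ.* r ℕ.!      ≡⟨ NP.*-assoc (j C r) (n C r) (r ℕ.!) ⟩
  (j C r) ℕ.* ((n C r) ℕ.* r ℕ.!)    ≡⟨ cong ((j C r) ℕ.*_) (trans (sym (P′≡C*! r≤n)) (sym (P≡P′ r≤n))) ⟩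
  (j C r) ℕ.* (n P r)                ∎
  where open ≡-Reasoning
... | no r≰j = begin
  (n C r) ℕ.* (j P′ r)               ≡⟨ cong ((n C r) ℕ.*_) (P′-< j r (NP.≰⇒> r≰j)) ⟩
  (n C r) ℕ.* 0                      ≡⟨ NP.*-zeroʳ (n C r) ⟩
  0                                  ≡⟨ cong (ℕ._* (n P r)) (k>n⇒nCk≡0 (NP.≰⇒> r≰j)) ⟨
  (j C r) ℕ.* (n P r)                ∎
  where open ≡-Reasoning

binomial-weight : ∀ n j r (a b : ℚ) → r ≤ n →
  ℕtoℚ (n C r) * a * b * inv (n P r) * ℕtoℚ (j P′ r) ≡ ℕtoℚ (j C r) * a * b
binomial-weight n j r a b r≤n = begin
  ℕtoℚ (n C r) * a * b * inv (n P r) * ℕtoℚ (j P′ r)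
    ≡⟨ solve 5 (λ NC A B I JP → NC :* A :* B :* I :* JP := NC :* JP :* I :* A :* B)
         refl (ℕtoℚ (n C r)) a b (inv (n P r)) (ℕtoℚ (j P′ r)) ⟩
  ℕtoℚ (n C r) * ℕtoℚ (j P′ r) * inv (n P r) * a * b
    ≡⟨ cong (λ c → c * inv (n P r) * a * b) (trans (sym (ℕtoℚ-homo-* (n C r) (j P′ r)))
         (trans (cong ℕtoℚ (C*P′≡C*P n j r r≤n)) (ℕtoℚ-homo-* (j C r) (n P r)))) ⟩
  ℕtoℚ (j C r) * ℕtoℚ (n P r) * inv (n P r) * a * b
    ≡⟨ cong (λ c → c * a * b) (QP.*-assoc (ℕtoℚ (j C r)) (ℕtoℚ (n P r)) (inv (n P r))) ⟩
  ℕtoℚ (j C r) * (ℕtoℚ (n P r) * inv (n P r)) * a * b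
    ≡⟨ cong (λ c → ℕtoℚ (j C r) * c * a * b) nPr*inv≡1 ⟩
  ℕtoℚ (j C r) * 1ℚ * a * b
    ≡⟨ cong (λ c → c * a * b) (QP.*-identityʳ (ℕtoℚ (j C r))) ⟩
  ℕtoℚ (j C r) * a * b ∎
  where
  open ≡-Reasoning
  nPr*inv≡1 : ℕtoℚ (n P r) * inv (n P r) ≡ 1ℚ
  nPr*inv≡1 rewrite P≡P′ r≤n = inv-inverseʳ (n P′ r) {{P′-nonZero r≤n}}

sum-fτ-fibre : ∀ n r {τ σ} → τ ∈ perms n → σ ∈ perms n → r ≤ n →
  sumQ (map (λ y → indicator (eqL (filter (r ℕ.<?_) y) (map (r ℕ.+_) (std (drop r σ)))) * fτ n τ y) (perms n))
  ≡ ℕtoℚ (jOf τ P′ r) * fτ n τ σ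
sum-fτ-fibre n r {τ} τ∈ σ∈ r≤n =
  trans (sum-fibre n r r≤n (std-drop-∈-perms r n σ∈) (fτ n τ)) (sum-fτ-insertionsRun n r τ∈ σ∈ r≤n)

binomial-eigen : ∀ n q {τ σ} → τ ∈ perms n → σ ∈ perms n →
  applyK n (Kbin n q) (fτ n τ) σ ≡ (q ^Q (n ∸ jOf τ)) * fτ n τ σ
binomial-eigen n q {τ} {σ} τ∈ σ∈ = begin
  applyK n (Kbin n q) f σ
    ≡⟨⟩
  sumQ (map (λ y → sumQ (map (λ r → T r y) Rs) * f y) (perms n))
    ≡⟨ sumQ-cong _ _ (perms n) (λ y _ → sumQ-*ʳ (λ r → T r y) (f y) Rs) ⟨
  sumQ (map (λ y → sumQ (map (λ r → T r y * f y) Rs)) (perms n))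
    ≡⟨ sumQ-swap (λ y r → T r y * f y) (perms n) Rs ⟩
  sumQ (map (λ r → sumQ (map (λ y → T r y * f y) (perms n))) Rs)
    ≡⟨ sumQ-cong _ _ Rs (λ r r∈ → per-r r (NP.≤-pred (∈-upTo⁻ r∈))) ⟩
  sumQ (map (λ r → c r * inv (n P r) * ℕtoℚ (j P′ r) * f σ) Rs)
    ≡⟨ sumQ-*ʳ (λ r → c r * inv (n P r) * ℕtoℚ (j P′ r)) (f σ) Rs ⟩
  sumQ (map (λ r → c r * inv (n P r) * ℕtoℚ (j P′ r)) Rs) * f σ
    ≡⟨ cong (_* f σ) (sumQ-cong _ _ Rs (λ r r∈ →
         binomial-weight n j r ((1ℚ - q) ^Q r) (q ^Q (n ∸ r)) (NP.≤-pred (∈-upTo⁻ r∈)))) ⟩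
  Binomial.S (1ℚ - q) q 1-q+q≡1 j n * f σ
    ≡⟨ cong (_* f σ) (Binomial.binomial (1ℚ - q) q 1-q+q≡1 j n (jOf-≤ n τ∈)) ⟩
  q ^Q (n ∸ j) * f σ
    ∎
  where
  open ≡-Reasoning
  f  = fτ n τ
  j  = jOf τ
  Rs = upTo (suc n)
  c : ℕ → ℚ
  c r = ℕtoℚ (n C r) * ((1ℚ - q) ^Q r) * (q ^Q (n ∸ r))
  ind : ℕ → List ℕ → ℚ
  ind r y = indicator (eqL (filter (r ℕ.<?_) y) (map (r ℕ.+_) (std (drop r σ))))
  T : ℕ → List ℕ → ℚ
  T r y = c r * ind r y * inv (n P r)
  1-q+q≡1 : (1ℚ - q) + q ≡ 1ℚ
  1-q+q≡1 = solve 1 (λ Q → (con 1ℚ :+ (:- Q)) :+ Q := con 1ℚ) refl q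
  per-r : ∀ r → r ≤ n → sumQ (map (λ y → T r y * f y) (perms n)) ≡ c r * inv (n P r) * ℕtoℚ (j P′ r) * f σ
  per-r r r≤n = begin
    sumQ (map (λ y → T r y * f y) (perms n))
      ≡⟨ sumQ-cong _ _ (perms n) (λ y _ →
           solve 4 (λ C I V X → C :* I :* V :* X := (C :* V) :* (I :* X)) refl (c r) (ind r y) (inv (n P r)) (f y)) ⟩
    sumQ (map (λ y → (c r * inv (n P r)) * (ind r y * f y)) (perms n))
      ≡⟨ sumQ-*ˡ (c r * inv (n P r)) (λ y → ind r y * f y) (perms n) ⟩
    (c r * inv (n P r)) * sumQ (map (λ y → ind r y * f y) (perms n))
      ≡⟨ cong (c r * inv (n P r) *_) (sum-fτ-fibre n r τ∈ σ∈ r≤n) ⟩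
    (c r * inv (n P r)) * (ℕtoℚ (j P′ r) * f σ)
      ≡⟨ QP.*-assoc (c r * inv (n P r)) (ℕtoℚ (j P′ r)) (f σ) ⟨
    c r * inv (n P r) * ℕtoℚ (j P′ r) * f σ ∎

-- The basis property

prepend1 : List ℕ → List ℕ
prepend1 ρ = 1 ∷ map suc ρ

laterInsertions : List ℕ → List (List ℕ)
laterInsertions []      = []
laterInsertions (x ∷ ρ) = map (suc x ∷_) (insertions 1 (map suc ρ))

insertions-1-split : ∀ ρ → insertions 1 (map suc ρ) ≡ prepend1 ρ ∷ laterInsertions ρ
insertions-1-split []      = refl
insertions-1-split (x ∷ ρ) = refl

prepend1-injective : ∀ {ρ ρ′} → prepend1 ρ ≡ prepend1 ρ′ → ρ ≡ ρ′
prepend1-injective eq = LP.map-injective NP.suc-injective (proj₂ (LP.∷-injective eq))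

1∉map-suc-perm : ∀ n {ρ} → ρ ∈ perms n → 1 ∉ map suc ρ
1∉map-suc-perm n ρ∈ 1∈ with ∈-map⁻ suc 1∈
... | z , z∈ , 1≡1+z = NP.<-irrefl (NP.suc-injective 1≡1+z) (proj₁ (∈-perms-bounds n ρ∈ z∈))

later⊆insertions : ∀ ρ {τ} → τ ∈ laterInsertions ρ → τ ∈ insertions 1 (map suc ρ)
later⊆insertions ρ τ∈ = subst (_ ∈_) (sym (insertions-1-split ρ)) (there τ∈)

laterInsertions-unique : ∀ n {ρ} → ρ ∈ perms n → Unique (laterInsertions ρ)
laterInsertions-unique n {ρ} ρ∈ with subst Unique (insertions-1-split ρ) (insertions-unique (map suc ρ) (1∉map-suc-perm n ρ∈))
... | _ ∷ u = u

laterInsertions-disjoint : ∀ n {ρ ρ′ τ} → ρ ∈ perms n → ρ′ ∈ perms n →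
  τ ∈ laterInsertions ρ → τ ∈ laterInsertions ρ′ → ρ ≡ ρ′
laterInsertions-disjoint n {ρ} {ρ′} ρ∈ ρ′∈ τ∈ τ∈′ = LP.map-injective NP.suc-injective
  (insertions-injective (1∉map-suc-perm n ρ∈) (1∉map-suc-perm n ρ′∈) (later⊆insertions ρ τ∈) (later⊆insertions ρ′ τ∈′))

prepend1-∈-perms : ∀ n {ρ} → ρ ∈ perms n → prepend1 ρ ∈ perms (suc n)
prepend1-∈-perms n ρ∈ = ∈-perms-suc⁺ n ρ∈ (head∈insertions 1 _)

later-∈-perms : ∀ n {ρ τ} → ρ ∈ perms n → τ ∈ laterInsertions ρ → τ ∈ perms (suc n)
later-∈-perms n {ρ} ρ∈ τ∈ = ∈-perms-suc⁺ n ρ∈ (later⊆insertions ρ τ∈)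

∈-laterInsertions⁻ : ∀ n {ρ τ} → ρ ∈ perms n → τ ∈ laterInsertions ρ →
  Σ ℕ λ x → Σ (List ℕ) λ ρt → Σ (List ℕ) λ l → ρ ≡ suc x ∷ ρt × τ ≡ suc (suc x) ∷ l × l ∈ insertions 1 (map suc ρt)
∈-laterInsertions⁻ n {zero ∷ ρt}  ρ∈ _  = ⊥-elim (NP.<-irrefl refl (proj₁ (∈-perms-bounds n ρ∈ (here refl))))
∈-laterInsertions⁻ n {suc x ∷ ρt} ρ∈ τ∈ with ∈-map⁻ (suc (suc x) ∷_) τ∈
... | l , l∈ , refl = x , ρt , l , refl , refl , l∈

later≢prepend1 : ∀ n {ρ τ} → ρ ∈ perms n → τ ∈ laterInsertions ρ → ∀ ρ′ → τ ≢ prepend1 ρ′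
later≢prepend1 n ρ∈ τ∈ ρ′ with ∈-laterInsertions⁻ n ρ∈ τ∈
... | _ , _ , _ , _ , refl , _ = λ ()

perms-suc-cases : ∀ n {σ} → σ ∈ perms (suc n) → Σ (List ℕ) λ ρ → ρ ∈ perms n × (σ ≡ prepend1 ρ ⊎ σ ∈ laterInsertions ρ)
perms-suc-cases n {σ} σ∈ =
  let ρ , ρ∈ , σ∈ρ = ∈-perms-suc⁻ n σ∈ in ρ , ρ∈ , case (subst (σ ∈_) (insertions-1-split ρ) σ∈ρ)
  where
  case : ∀ {τ τs} → σ ∈ τ ∷ τs → σ ≡ τ ⊎ σ ∈ τs
  case (here σ≡τ) = inj₁ σ≡τ
  case (there σ∈) = inj₂ σ∈

filter-≢-map-suc : ∀ a l → filter (λ v → ¬? (v ℕ.≟ suc a)) (map suc l) ≡ map suc (filter (λ v → ¬? (v ℕ.≟ a)) l)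
filter-≢-map-suc a []      = refl
-- `does (suc x ≟ suc a)` and `does (x ≟ a)` both compute to `x ≡ᵇ a`.
filter-≢-map-suc a (x ∷ l) with x ℕ.≡ᵇ a
... | true  = filter-≢-map-suc a l
... | false = cong (suc x ∷_) (filter-≢-map-suc a l)

pattern₁-prepend1 : ∀ j ρ → pattern₁ (suc j) (prepend1 ρ) ≡ pattern₁ j ρ
pattern₁-prepend1 j ρ = trans (cong std (LP.drop-map j ρ)) (std-map-suc (drop j ρ))

pattern₂-prepend1 : ∀ j ρ → pattern₂ (suc j) (prepend1 ρ) ≡ pattern₂ j ρ
pattern₂-prepend1 j ρ = begin
  std (suc (suc j) ∷ filter (λ v → ¬? (v ℕ.≟ suc (suc j))) (drop j (map suc ρ)))
    ≡⟨ cong (λ l → std (suc (suc j) ∷ filter (λ v → ¬? (v ℕ.≟ suc (suc j))) l)) (LP.drop-map j ρ) ⟩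
  std (suc (suc j) ∷ filter (λ v → ¬? (v ℕ.≟ suc (suc j))) (map suc (drop j ρ)))
    ≡⟨ cong (λ l → std (suc (suc j) ∷ l)) (filter-≢-map-suc (suc j) (drop j ρ)) ⟩
  std (map suc (suc j ∷ filter (λ v → ¬? (v ℕ.≟ suc j)) (drop j ρ)))
    ≡⟨ std-map-suc _ ⟩
  pattern₂ j ρ ∎
  where open ≡-Reasoning

std-drop-suc : ∀ j σ → std (drop (suc j) σ) ≡ std (drop j (std (tail' σ)))
std-drop-suc j []      = cong std (trans (LP.drop-[] (suc j)) (sym (LP.drop-[] j)))
std-drop-suc j (x ∷ σ) = sym (std-drop-std j σ)

fτ-prepend1 : ∀ n {ρ} σ → ρ ∈ perms n → fτ (suc n) (prepend1 ρ) σ ≡ fτ n ρ (std (tail' σ))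
fτ-prepend1 n {ρ} σ ρ∈ with jOf ρ ℕ.≟ n
... | yes j≡n = trans (fτ-id (suc n) (prepend1 ρ) σ (trans (jOf-1∷map-suc ρ) (cong suc j≡n))) (sym (fτ-id n ρ _ j≡n))
... | no  j≢n = begin
  fτ (suc n) (prepend1 ρ) σ
    ≡⟨ fτ-F (suc n) (prepend1 ρ) σ (j≢n ∘ NP.suc-injective ∘ trans (sym (jOf-1∷map-suc ρ))) ⟩
  F-at (jOf (prepend1 ρ))
    ≡⟨ cong F-at (jOf-1∷map-suc ρ) ⟩
  F-at (suc (jOf ρ))
    ≡⟨ cong₂ (λ T₁ T₂ → F T₁ T₂ (std (drop (suc (jOf ρ)) σ))) (pattern₁-prepend1 (jOf ρ) ρ)
         (pattern₂-prepend1 (jOf ρ) ρ) ⟩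
  F (pattern₁ (jOf ρ) ρ) (pattern₂ (jOf ρ) ρ) (std (drop (suc (jOf ρ)) σ))
    ≡⟨ cong (F (pattern₁ (jOf ρ) ρ) (pattern₂ (jOf ρ) ρ)) (std-drop-suc (jOf ρ) σ) ⟩
  F (pattern₁ (jOf ρ) ρ) (pattern₂ (jOf ρ) ρ) (std (drop (jOf ρ) (std (tail' σ))))
    ≡⟨ fτ-F n ρ (std (tail' σ)) j≢n ⟨
  fτ n ρ (std (tail' σ)) ∎
  where
  open ≡-Reasoning
  F-at : ℕ → ℚ
  F-at J = F (pattern₁ J (prepend1 ρ)) (pattern₂ J (prepend1 ρ)) (std (drop J σ))

fτ-later : ∀ n {ρ τ σ} → ρ ∈ perms n → τ ∈ laterInsertions ρ → σ ∈ perms (suc n) →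
  fτ (suc n) τ σ ≡ F τ (prepend1 ρ) σ
fτ-later n {ρ} {τ} {σ} ρ∈ τ∈ σ∈ with ∈-laterInsertions⁻ n ρ∈ τ∈
... | x , ρt , l , refl , refl , l∈ = begin
  fτ (suc n) τ σ
    ≡⟨ fτ-F (suc n) τ σ (λ ()) ⟩
  F (std τ) (std (1 ∷ filter ≢1? τ)) (std σ)
    ≡⟨ cong (λ l → F (std τ) (std (1 ∷ l)) (std σ)) filter≡ ⟩
  F (std τ) (std (prepend1 ρ)) (std σ)
    ≡⟨ cong₂ (λ T₁ T₂ → F T₁ T₂ (std σ)) (std-perm (suc n) τ∈n) (std-perm (suc n) (prepend1-∈-perms n ρ∈)) ⟩
  F τ (prepend1 ρ) (std σ)
    ≡⟨ cong (F τ (prepend1 ρ)) (std-perm (suc n) σ∈) ⟩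
  F τ (prepend1 ρ) σ ∎
  where
  open ≡-Reasoning
  ≢1? : Decidable (_≢ 1)
  ≢1? v = ¬? (v ℕ.≟ 1)
  τ∈n : τ ∈ perms (suc n)
  τ∈n = later-∈-perms n ρ∈ τ∈
  filter≡ : filter ≢1? τ ≡ map suc ρ
  filter≡ = trans (filter-insertions ≢1? (map suc ρ) (λ 1≢1 → 1≢1 refl) (later⊆insertions ρ τ∈))
                  (LP.filter-all ≢1? (All.tabulate λ { v∈ refl → 1∉map-suc-perm n ρ∈ v∈ }))

F-≢₂ : ∀ T₁ T₂ s → s ≢ T₂ → F T₁ T₂ s ≡ indicator (eqL s T₁)
F-≢₂ T₁ T₂ s s≢T₂ with eqL s T₁
... | true  = refl
... | false = cong (λ b → if b then - 1ℚ else 0ℚ) (eqL-≢ s≢T₂)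

F-≢₁ : ∀ T₁ T₂ s → s ≢ T₁ → F T₁ T₂ s ≡ indicator (eqL s T₂) * - 1ℚ
F-≢₁ T₁ T₂ s s≢T₁ rewrite eqL-≢ s≢T₁ with eqL s T₂
... | true  = sym (QP.*-identityˡ (- 1ℚ))
... | false = sym (QP.*-zeroˡ (- 1ℚ))

lincomb : ℕ → (List ℕ → ℚ) → List ℕ → ℚ
lincomb n c σ = sumQ (map (λ τ → c τ * fτ n τ σ) (perms n))

lincomb-suc : ∀ n c {σ} → σ ∈ perms (suc n) →
  lincomb (suc n) c σ ≡ lincomb n (c ∘ prepend1) (std (tail' σ))
                        + sumQ (map (λ ρ → sumQ (map (λ τ → c τ * F τ (prepend1 ρ) σ) (laterInsertions ρ))) (perms n))
lincomb-suc n c {σ} σ∈ = begin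
  sumQ (map h (perms (suc n)))
    ≡⟨ sumQ-↭ h (perms↭permsSplit 1 n) ⟩
  sumQ (map h (permsSplit 1 n))
    ≡⟨ sumQ-concatMap h (λ ρ → insertionsRun 1 1 (map suc ρ)) (perms n) ⟩
  sumQ (map (λ ρ → sumQ (map h (insertions 1 (map suc ρ) ++ []))) (perms n))
    ≡⟨ sumQ-cong _ _ (perms n) per-ρ ⟩
  sumQ (map (λ ρ → A ρ + B ρ) (perms n))
    ≡⟨ sumQ-+ A B (perms n) ⟩
  sumQ (map A (perms n)) + sumQ (map B (perms n)) ∎
  where
  open ≡-Reasoning
  h : List ℕ → ℚ
  h τ = c τ * fτ (suc n) τ σ
  A B : List ℕ → ℚ
  A ρ = c (prepend1 ρ) * fτ n ρ (std (tail' σ))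
  B ρ = sumQ (map (λ τ → c τ * F τ (prepend1 ρ) σ) (laterInsertions ρ))
  per-ρ : ∀ ρ → ρ ∈ perms n → sumQ (map h (insertions 1 (map suc ρ) ++ [])) ≡ A ρ + B ρ
  per-ρ ρ ρ∈ = begin
    sumQ (map h (insertions 1 (map suc ρ) ++ []))
      ≡⟨ cong (sumQ ∘ map h) (trans (LP.++-identityʳ _) (insertions-1-split ρ)) ⟩
    h (prepend1 ρ) + sumQ (map h (laterInsertions ρ))
      ≡⟨ cong₂ _+_ (cong (c (prepend1 ρ) *_) (fτ-prepend1 n σ ρ∈))
           (sumQ-cong _ _ (laterInsertions ρ) (λ τ τ∈ → cong (c τ *_) (fτ-later n ρ∈ τ∈ σ∈))) ⟩
    A ρ + B ρ ∎

lincomb-later : ∀ n c {ρσ σ} → ρσ ∈ perms n → σ ∈ laterInsertions ρσ →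
  lincomb (suc n) c σ ≡ lincomb n (c ∘ prepend1) (std (tail' σ)) + c σ
lincomb-later n c {ρσ} {σ} ρσ∈ σ∈ =
  trans (lincomb-suc n c (later-∈-perms n ρσ∈ σ∈)) (cong (lincomb n (c ∘ prepend1) (std (tail' σ)) +_) (begin
  sumQ (map (λ ρ → sumQ (map (λ τ → c τ * F τ (prepend1 ρ) σ) (laterInsertions ρ))) (perms n))
    ≡⟨ sumQ-cong _ _ (perms n) (λ ρ ρ∈ → trans (sumQ-cong _ _ (laterInsertions ρ) (λ τ _ →
         trans (cong (c τ *_) (F-≢₂ τ (prepend1 ρ) σ (later≢prepend1 n ρσ∈ σ∈ ρ))) (QP.*-comm (c τ) _))) (at-ρ ρ ρ∈)) ⟩
  sumQ (map (λ ρ → indicator (eqL ρσ ρ) * c σ) (perms n))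
    ≡⟨ sumQ-indicator ρσ (λ _ → c σ) (perms n) (perms-unique n) ρσ∈ ⟩
  c σ
    ∎))
  where
  open ≡-Reasoning
  at-ρ : ∀ ρ → ρ ∈ perms n → sumQ (map (λ τ → indicator (eqL σ τ) * c τ) (laterInsertions ρ)) ≡ indicator (eqL ρσ ρ) * c σ
  at-ρ ρ ρ∈ with LP.≡-dec ℕ._≟_ ρσ ρ
  ... | yes refl = trans (sumQ-indicator σ c (laterInsertions ρσ) (laterInsertions-unique n ρσ∈) σ∈) (sym (QP.*-identityˡ (c σ)))
  ... | no ρσ≢ρ  =
    trans (sumQ-indicator-∉ σ c (laterInsertions ρ) (ρσ≢ρ ∘ laterInsertions-disjoint n ρσ∈ ρ∈ σ∈)) (sym (QP.*-zeroˡ (c σ)))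

lincomb-prepend1 : ∀ n c {ρ₀} → ρ₀ ∈ perms n →
  lincomb (suc n) c (prepend1 ρ₀) ≡ lincomb n (c ∘ prepend1) ρ₀ + - sumQ (map c (laterInsertions ρ₀))
lincomb-prepend1 n c {ρ₀} ρ₀∈ = begin
  lincomb (suc n) c (prepend1 ρ₀)
    ≡⟨ lincomb-suc n c (prepend1-∈-perms n ρ₀∈) ⟩
  lincomb n (c ∘ prepend1) (std (map suc ρ₀))
    + sumQ (map (λ ρ → sumQ (map (λ τ → c τ * F τ (prepend1 ρ) (prepend1 ρ₀)) (laterInsertions ρ))) (perms n))
    ≡⟨ cong₂ _+_ (cong (lincomb n (c ∘ prepend1)) (trans (std-map-suc ρ₀) (std-perm n ρ₀∈))) (sumQ-cong _ _ (perms n) at-ρ) ⟩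
  lincomb n (c ∘ prepend1) ρ₀ + sumQ (map (λ ρ → indicator (eqL ρ₀ ρ) * - sumQ (map c (laterInsertions ρ))) (perms n))
    ≡⟨ cong (lincomb n (c ∘ prepend1) ρ₀ +_)
         (sumQ-indicator ρ₀ (λ ρ → - sumQ (map c (laterInsertions ρ))) (perms n) (perms-unique n) ρ₀∈) ⟩
  lincomb n (c ∘ prepend1) ρ₀ + - sumQ (map c (laterInsertions ρ₀))
    ∎
  where
  open ≡-Reasoning
  at-ρ : ∀ ρ → ρ ∈ perms n →
    sumQ (map (λ τ → c τ * F τ (prepend1 ρ) (prepend1 ρ₀)) (laterInsertions ρ))
    ≡ indicator (eqL ρ₀ ρ) * - sumQ (map c (laterInsertions ρ))
  at-ρ ρ ρ∈ = begin
    sumQ (map (λ τ → c τ * F τ (prepend1 ρ) (prepend1 ρ₀)) (laterInsertions ρ))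
      ≡⟨ sumQ-cong _ _ (laterInsertions ρ) (λ τ τ∈ → trans
           (cong (c τ *_) (F-≢₁ τ (prepend1 ρ) (prepend1 ρ₀) (λ eq → later≢prepend1 n ρ∈ τ∈ ρ₀ (sym eq))))
           (solve 2 (λ C I → C :* (I :* (:- con 1ℚ)) := I :* (:- C)) refl (c τ) b)) ⟩
    sumQ (map (λ τ → b * - c τ) (laterInsertions ρ))
      ≡⟨ sumQ-*ˡ b (λ τ → - c τ) (laterInsertions ρ) ⟩
    b * sumQ (map (λ τ → - c τ) (laterInsertions ρ))
      ≡⟨ cong₂ _*_ (cong indicator (eqL-injective prepend1-injective ρ₀ ρ)) (sumQ-neg c (laterInsertions ρ)) ⟩
    indicator (eqL ρ₀ ρ) * - sumQ (map c (laterInsertions ρ))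
      ∎
    where b = indicator (eqL (prepend1 ρ₀) (prepend1 ρ))

sum-later-std-tail : ∀ n {ρ₀} → ρ₀ ∈ perms (suc n) → (G : List ℕ → ℚ) →
  sumQ (map (G ∘ std ∘ tail') (laterInsertions ρ₀)) ≡ sumQ (map G (insertions 1 (map suc (std (tail' ρ₀)))))
sum-later-std-tail n {[]}     ρ₀∈ G = ⊥-elim (NP.0≢1+n (length-∈-perms (suc n) ρ₀∈))
sum-later-std-tail n {x ∷ ρt} ρ₀∈ G = begin
  sumQ (map (G ∘ std ∘ tail') (map (suc x ∷_) (insertions 1 (map suc ρt))))
    ≡⟨ cong sumQ (LP.map-∘ (insertions 1 (map suc ρt))) ⟨
  sumQ (map (G ∘ std) (insertions 1 (map suc ρt)))
    ≡⟨ cong sumQ (LP.map-∘ (insertions 1 (map suc ρt))) ⟩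
  sumQ (map G (map std (insertions 1 (map suc ρt))))
    ≡⟨ cong (sumQ ∘ map G) (std-insertions 1 (map suc ρt) ρt>1) ⟩
  sumQ (map G (insertions 1 (map suc (std (map suc ρt)))))
    ≡⟨ cong (λ l → sumQ (map G (insertions 1 (map suc l)))) (std-map-suc ρt) ⟩
  sumQ (map G (insertions 1 (map suc (std ρt)))) ∎
  where
  open ≡-Reasoning
  ρt>1 : Above 2 (map suc ρt)
  ρt>1 y∈ with ∈-map⁻ suc y∈
  ... | z , z∈ , refl = s≤s (proj₁ (∈-perms-bounds (suc n) ρ₀∈ (there z∈)))

lincomb-+ : ∀ n c d σ → lincomb n c σ + lincomb n d σ ≡ lincomb n (λ τ → c τ + d τ) σ
lincomb-+ n c d σ = trans (sym (sumQ-+ (λ τ → c τ * fτ n τ σ) (λ τ → d τ * fτ n τ σ) (perms n)))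
  (sumQ-cong _ _ (perms n) (λ τ _ → sym (QP.*-distribʳ-+ (fτ n τ σ) (c τ) (d τ))))

lincomb-insertions : ∀ n e {ρ₀} → ρ₀ ∈ perms (suc n) →
  sumQ (map (lincomb (suc n) e) (insertions 1 (map suc (std (tail' ρ₀))))) ≡ lincomb (suc n) (λ ρ → e ρ * ℕtoℚ (jOf ρ)) ρ₀
lincomb-insertions n e {ρ₀} ρ₀∈ = begin
  sumQ (map (λ l → sumQ (map (λ ρ → e ρ * fτ (suc n) ρ l) Ps)) Ls)
    ≡⟨ sumQ-swap (λ l ρ → e ρ * fτ (suc n) ρ l) Ls Ps ⟩
  sumQ (map (λ ρ → sumQ (map (λ l → e ρ * fτ (suc n) ρ l) Ls)) Ps)
    ≡⟨ sumQ-cong _ _ Ps (λ ρ ρ∈ → trans (sumQ-*ˡ (e ρ) (fτ (suc n) ρ) Ls)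
         (cong (e ρ *_) (sum-fτ-insertions (suc n) ρ∈ ρ₀∈ (s≤s z≤n)))) ⟩
  sumQ (map (λ ρ → e ρ * (ℕtoℚ (jOf ρ) * fτ (suc n) ρ ρ₀)) Ps)
    ≡⟨ sumQ-cong _ _ Ps (λ ρ _ → sym (QP.*-assoc (e ρ) _ _)) ⟩
  lincomb (suc n) (λ ρ → e ρ * ℕtoℚ (jOf ρ)) ρ₀ ∎
  where
  open ≡-Reasoning
  Ps = perms (suc n)
  Ls = insertions 1 (map suc (std (tail' ρ₀)))

lincomb-prepend1-later : ∀ n e {ρ₀} → ρ₀ ∈ perms (suc n) →
  lincomb (suc n) e ρ₀ + sumQ (map (lincomb (suc n) e ∘ std ∘ tail') (laterInsertions ρ₀))
  ≡ lincomb (suc n) (λ ρ → e ρ * ℕtoℚ (suc (jOf ρ))) ρ₀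
lincomb-prepend1-later n e {ρ₀} ρ₀∈ = begin
  lincomb (suc n) e ρ₀ + sumQ (map (lincomb (suc n) e ∘ std ∘ tail') (laterInsertions ρ₀))
    ≡⟨ cong (lincomb (suc n) e ρ₀ +_) (trans (sum-later-std-tail n ρ₀∈ (lincomb (suc n) e)) (lincomb-insertions n e ρ₀∈)) ⟩
  lincomb (suc n) e ρ₀ + lincomb (suc n) (λ ρ → e ρ * ℕtoℚ (jOf ρ)) ρ₀
    ≡⟨ lincomb-+ (suc n) e _ ρ₀ ⟩
  lincomb (suc n) (λ ρ → e ρ + e ρ * ℕtoℚ (jOf ρ)) ρ₀
    ≡⟨ sumQ-cong _ _ (perms (suc n)) (λ ρ _ → cong (_* fτ (suc n) ρ ρ₀) (e+ej≡e[1+j] ρ)) ⟩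
  lincomb (suc n) (λ ρ → e ρ * ℕtoℚ (suc (jOf ρ))) ρ₀
    ∎
  where
  open ≡-Reasoning
  e+ej≡e[1+j] : ∀ ρ → e ρ + e ρ * ℕtoℚ (jOf ρ) ≡ e ρ * ℕtoℚ (suc (jOf ρ))
  e+ej≡e[1+j] ρ = sym (trans (cong (e ρ *_) (ℕtoℚ-homo-+ 1 (jOf ρ)))
                             (trans (QP.*-distribˡ-+ (e ρ) 1ℚ (ℕtoℚ (jOf ρ))) (cong (_+ e ρ * ℕtoℚ (jOf ρ)) (QP.*-identityʳ (e ρ)))))

Independent : ℕ → Set
Independent n = (c : List ℕ → ℚ) → (∀ σ → σ ∈ perms n → lincomb n c σ ≡ 0ℚ) → ∀ τ → τ ∈ perms n → c τ ≡ 0ℚ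

Spanning : ℕ → Set
Spanning n = (g : List ℕ → ℚ) → Σ (List ℕ → ℚ) λ c → ∀ σ → σ ∈ perms n → lincomb n c σ ≡ g σ

cancel-suc : ∀ a k → a * ℕtoℚ (suc k) ≡ 0ℚ → a ≡ 0ℚ
cancel-suc a k a[1+k]≡0 = begin
  a                                        ≡⟨ QP.*-identityʳ a ⟨
  a * 1ℚ                                   ≡⟨ cong (a *_) (inv-inverseʳ (suc k)) ⟨
  a * (ℕtoℚ (suc k) * inv (suc k))         ≡⟨ QP.*-assoc a (ℕtoℚ (suc k)) (inv (suc k)) ⟨
  a * ℕtoℚ (suc k) * inv (suc k)           ≡⟨ cong (_* inv (suc k)) a[1+k]≡0 ⟩
  0ℚ * inv (suc k)                         ≡⟨ QP.*-zeroˡ (inv (suc k)) ⟩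
  0ℚ                                       ∎
  where open ≡-Reasoning

lincomb-1 : ∀ c → lincomb 1 c (1 ∷ []) ≡ c (1 ∷ [])
lincomb-1 c = trans (QP.+-identityʳ (c (1 ∷ []) * 1ℚ)) (QP.*-identityʳ (c (1 ∷ [])))

independent-1 : Independent 1
independent-1 c vanish .(1 ∷ []) (here refl) = trans (sym (lincomb-1 c)) (vanish (1 ∷ []) (here refl))

module IndependenceStep (m : ℕ) (independent : Independent (suc m)) (c : List ℕ → ℚ)
                        (vanish : ∀ σ → σ ∈ perms (suc (suc m)) → lincomb (suc (suc m)) c σ ≡ 0ℚ) where

  c′ : List ℕ → ℚ
  c′ = c ∘ prepend1

  C : List ℕ → ℚ
  C = lincomb (suc m) c′

  later-coeff : ∀ {ρ τ} → ρ ∈ perms (suc m) → τ ∈ laterInsertions ρ → c τ ≡ - C (std (tail' τ))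
  later-coeff {ρ} {τ} ρ∈ τ∈ = inverseʳ-unique (C (std (tail' τ))) (c τ)
    (trans (sym (lincomb-later (suc m) c ρ∈ τ∈)) (vanish τ (later-∈-perms (suc m) ρ∈ τ∈)))

  weighted-vanish : ∀ ρ₀ → ρ₀ ∈ perms (suc m) → lincomb (suc m) (λ ρ → c′ ρ * ℕtoℚ (suc (jOf ρ))) ρ₀ ≡ 0ℚ
  weighted-vanish ρ₀ ρ₀∈ = begin
    lincomb (suc m) (λ ρ → c′ ρ * ℕtoℚ (suc (jOf ρ))) ρ₀
      ≡⟨ lincomb-prepend1-later m c′ ρ₀∈ ⟨
    C ρ₀ + sumQ (map (C ∘ std ∘ tail') L)
      ≡⟨ cong (C ρ₀ +_) Σ-later ⟩
    C ρ₀ + - sumQ (map c L)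
      ≡⟨ lincomb-prepend1 (suc m) c ρ₀∈ ⟨
    lincomb (suc (suc m)) c (prepend1 ρ₀)
      ≡⟨ vanish (prepend1 ρ₀) (prepend1-∈-perms (suc m) ρ₀∈) ⟩
    0ℚ ∎
    where
    open ≡-Reasoning
    L = laterInsertions ρ₀
    Σ-later : sumQ (map (C ∘ std ∘ tail') L) ≡ - sumQ (map c L)
    Σ-later = sym (trans (cong -_ (trans (sumQ-cong _ _ L (λ τ τ∈ → later-coeff ρ₀∈ τ∈)) (sumQ-neg (C ∘ std ∘ tail') L)))
                         (⁻¹-involutive _))

  c′≡0 : ∀ ρ → ρ ∈ perms (suc m) → c′ ρ ≡ 0ℚ
  c′≡0 ρ ρ∈ = cancel-suc (c′ ρ) (jOf ρ) (independent (λ ρ → c′ ρ * ℕtoℚ (suc (jOf ρ))) weighted-vanish ρ ρ∈)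

  C≡0 : ∀ σ → C σ ≡ 0ℚ
  C≡0 σ = sumQ-zero _ (perms (suc m)) (λ ρ ρ∈ → trans (cong (_* fτ (suc m) ρ σ) (c′≡0 ρ ρ∈)) (QP.*-zeroˡ (fτ (suc m) ρ σ)))

  c≡0 : ∀ τ → τ ∈ perms (suc (suc m)) → c τ ≡ 0ℚ
  c≡0 τ τ∈ = by-cases (perms-suc-cases (suc m) τ∈)
    where
    by-cases : Σ (List ℕ) (λ ρ → ρ ∈ perms (suc m) × (τ ≡ prepend1 ρ ⊎ τ ∈ laterInsertions ρ)) → c τ ≡ 0ℚ
    by-cases (ρ , ρ∈ , inj₁ refl)     = c′≡0 ρ ρ∈
    by-cases (ρ , ρ∈ , inj₂ τ∈later) = trans (later-coeff ρ∈ τ∈later) (cong -_ (C≡0 (std (tail' τ))))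

independent : ∀ n → Independent (suc n)
independent zero    = independent-1
independent (suc m) c vanish = c≡0
  where open IndependenceStep m (independent m) c vanish

spanning-1 : Spanning 1
spanning-1 g = (λ _ → g (1 ∷ [])) , represents
  where
  represents : ∀ σ → σ ∈ perms 1 → lincomb 1 (λ _ → g (1 ∷ [])) σ ≡ g σ
  represents .(1 ∷ []) (here refl) = lincomb-1 (λ _ → g (1 ∷ []))

module SpanningStep (m : ℕ) (spanning : Spanning (suc m)) (g : List ℕ → ℚ) where

  sg : List ℕ → ℚ
  sg ρ = sumQ (map g (insertions 1 (map suc ρ)))

  d : List ℕ → ℚ
  d = proj₁ (spanning sg)

  e : List ℕ → ℚ
  e ρ = d ρ * inv (suc (jOf ρ))

  G : List ℕ → ℚ
  G = lincomb (suc m) e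

  -- On 1 ∷ (ρ+1) the coefficient solves the system for sg on 𝔖_{m+1}, rescaled by 1 + j(ρ);
  -- on a later insertion it is then forced by g.
  c : List ℕ → ℚ
  c (suc zero ∷ τ′) = e (std τ′)
  c τ               = g τ - G (std (tail' τ))

  c∘prepend1 : ∀ x → lincomb (suc m) (c ∘ prepend1) x ≡ G x
  c∘prepend1 x = sumQ-cong _ _ (perms (suc m)) (λ ρ ρ∈ →
    cong (λ ρ′ → e ρ′ * fτ (suc m) ρ x) (trans (std-map-suc ρ) (std-perm (suc m) ρ∈)))

  c-later : ∀ {ρ τ} → ρ ∈ perms (suc m) → τ ∈ laterInsertions ρ → c τ ≡ g τ - G (std (tail' τ))
  c-later ρ∈ τ∈ with ∈-laterInsertions⁻ (suc m) ρ∈ τ∈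
  ... | _ , _ , _ , _ , refl , _ = refl

  e[1+j]≡d : ∀ ρ → e ρ * ℕtoℚ (suc (jOf ρ)) ≡ d ρ
  e[1+j]≡d ρ = trans (QP.*-assoc (d ρ) _ _) (trans (cong (d ρ *_) (inv-inverseˡ (suc (jOf ρ)))) (QP.*-identityʳ (d ρ)))

  at-prepend1 : ∀ ρ₀ → ρ₀ ∈ perms (suc m) → lincomb (suc (suc m)) c (prepend1 ρ₀) ≡ g (prepend1 ρ₀)
  at-prepend1 ρ₀ ρ₀∈ = begin
    lincomb (suc (suc m)) c (prepend1 ρ₀)
      ≡⟨ lincomb-prepend1 (suc m) c ρ₀∈ ⟩
    lincomb (suc m) (c ∘ prepend1) ρ₀ + - sumQ (map c L)
      ≡⟨ cong₂ (λ a b → a + - b) (c∘prepend1 ρ₀) Σc ⟩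
    G ρ₀ + - (sumQ (map g L) + - sumQ (map (G ∘ std ∘ tail') L))
      ≡⟨ solve 3 (λ a t u → a :+ (:- (t :+ (:- u))) := (a :+ u) :+ (:- t)) refl
           (G ρ₀) (sumQ (map g L)) (sumQ (map (G ∘ std ∘ tail') L)) ⟩
    (G ρ₀ + sumQ (map (G ∘ std ∘ tail') L)) + - sumQ (map g L)
      ≡⟨ cong (_+ - sumQ (map g L)) (lincomb-prepend1-later m e ρ₀∈) ⟩
    lincomb (suc m) (λ ρ → e ρ * ℕtoℚ (suc (jOf ρ))) ρ₀ + - sumQ (map g L)
                                                                   ≡⟨ cong (_+ - sumQ (map g L)) (sumQ-cong _ _ (perms (suc m)) (λ ρ _ → cong (_* _) (e[1+j]≡d ρ))) ⟩
    lincomb (suc m) d ρ₀ + - sumQ (map g L)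
      ≡⟨ cong (_+ - sumQ (map g L)) (proj₂ (spanning sg) ρ₀ ρ₀∈) ⟩
    sg ρ₀ + - sumQ (map g L)
      ≡⟨ cong (λ ls → sumQ (map g ls) + - sumQ (map g L)) (insertions-1-split ρ₀) ⟩
    (g (prepend1 ρ₀) + sumQ (map g L)) + - sumQ (map g L)
      ≡⟨ solve 2 (λ a t → (a :+ t) :+ (:- t) := a) refl (g (prepend1 ρ₀)) (sumQ (map g L)) ⟩
    g (prepend1 ρ₀) ∎
    where
    open ≡-Reasoning
    L = laterInsertions ρ₀
    Σc : sumQ (map c L) ≡ sumQ (map g L) + - sumQ (map (G ∘ std ∘ tail') L)
    Σc = trans (sumQ-cong _ _ L (λ τ τ∈ → c-later ρ₀∈ τ∈))
               (trans (sumQ-+ g (λ τ → - G (std (tail' τ))) L) (cong (sumQ (map g L) +_) (sumQ-neg (G ∘ std ∘ tail') L)))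

  at-later : ∀ {ρ σ} → ρ ∈ perms (suc m) → σ ∈ laterInsertions ρ → lincomb (suc (suc m)) c σ ≡ g σ
  at-later {ρ} {σ} ρ∈ σ∈later = begin
    lincomb (suc (suc m)) c σ
      ≡⟨ lincomb-later (suc m) c ρ∈ σ∈later ⟩
    lincomb (suc m) (c ∘ prepend1) (std (tail' σ)) + c σ
      ≡⟨ cong₂ _+_ (c∘prepend1 (std (tail' σ))) (c-later ρ∈ σ∈later) ⟩
    G (std (tail' σ)) + (g σ - G (std (tail' σ)))
      ≡⟨ solve 2 (λ a b → a :+ (b :+ (:- a)) := b) refl (G (std (tail' σ))) (g σ) ⟩
    g σ ∎
    where open ≡-Reasoning

  represents : ∀ σ → σ ∈ perms (suc (suc m)) → lincomb (suc (suc m)) c σ ≡ g σ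
  represents σ σ∈ = by-cases (perms-suc-cases (suc m) σ∈)
    where
    by-cases : Σ (List ℕ) (λ ρ → ρ ∈ perms (suc m) × (σ ≡ prepend1 ρ ⊎ σ ∈ laterInsertions ρ)) →
               lincomb (suc (suc m)) c σ ≡ g σ
    by-cases (ρ , ρ∈ , inj₁ refl)     = at-prepend1 ρ ρ∈
    by-cases (ρ , ρ∈ , inj₂ σ∈later) = at-later ρ∈ σ∈later

spanning : ∀ n → Spanning (suc n)
spanning zero    = spanning-1
spanning (suc m) g = c , represents
  where open SpanningStep m (spanning m) g

theorem6p5 : (n : ℕ) → 2 ≤ n →
  ((τ : List ℕ) → τ ∈ perms n → (σ : List ℕ) → σ ∈ perms n →
    applyK n (Ktop n) (fτ n τ) σ ≡ (ℕtoℚ (jOf τ) * inv n) * fτ n τ σ)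
  × ((q₂ : ℚ) → 0ℚ ≤ℚ q₂ → q₂ ≤ℚ 1ℚ →
    (τ : List ℕ) → τ ∈ perms n → (σ : List ℕ) → σ ∈ perms n →
    applyK n (Kbin n q₂) (fτ n τ) σ ≡ (q₂ ^Q (n ∸ jOf τ)) * fτ n τ σ)
  × ((c : List ℕ → ℚ) →
    ((σ : List ℕ) → σ ∈ perms n → sumQ (map (λ τ → c τ * fτ n τ σ) (perms n)) ≡ 0ℚ) →
    (τ : List ℕ) → τ ∈ perms n → c τ ≡ 0ℚ)
  × ((g : List ℕ → ℚ) → Σ (List ℕ → ℚ) (λ c →
    (σ : List ℕ) → σ ∈ perms n → sumQ (map (λ τ → c τ * fτ n τ σ) (perms n)) ≡ g σ))
-- The identity for the binomial chain is polynomial in q₂.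
theorem6p5 (suc n) _ =
    (λ τ τ∈ σ σ∈ → top-to-random-eigen n τ∈ σ∈)
  , (λ q₂ _ _ τ τ∈ σ σ∈ → binomial-eigen (suc n) q₂ τ∈ σ∈)
  , independent n
  , spanning n
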